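{- Let $p$ be a prime and $F\colon\mathbb F_p^n\to\mathbb F_p^m$ an almost balanced surjective plateaued function. Then there is an integer $t$ such that $F$ is plateaued with single amplitude $p^{(n+t)/2}$ (i.e., $F$ is $t$-plateaued); moreover $n+t$ is even and $m\le (n+t)/2$.
   Context: Standard scalar product $\langle x,y\rangle=\sum_ix_iy_i$, $\zeta_p=e^{2\pi i/p}$. For $f\colon\mathbb F_p^n\to\mathbb F_p$, $W_f(a)=\sum_x\zeta_p^{f(x)-\langle a,x\rangle}$; $f$ is $t$-plateaued if $|W_f(a)|\in\{0,p^{(n+t)/2}\}$ for all $a$. For $F\colon\mathbb F_p^n\to\mathbb F_p^m$ and $b\in\mathbb F_p^m$, the component function is $F_b(x)=\langle b,F(x)\rangle$ and $W_F(b,a)=W_{F_b}(a)$. $F$ is plateaued if every $F_b$, $b\ne0$, is $s_b$-plateaued for some $s_b$; it is $t$-plateaued (plateaued with single amplitude $p^{(n+t)/2}$) if all $F_b$, $b\neq0$, are $t$-plateaued. The imbalance is $\mathcal N_F=\frac1{p^m}\sum_{b\neq0}|W_F(b,0)|^2$. With $\mathrm{Im}(F)$ the image set, $\Xi(F)=\sqrt{\frac{(|\mathrm{Im}(F)|-1)(|\mathrm{Im}(F)|\mathcal N_F-p^{2n-m}(p^m-|\mathrm{Im}(F)|))}{|\mathrm{Im}(F)|^2}}$, and every nonempty preimage satisfies $\frac{p^n}{|\mathrm{Im}(F)|}-\Xi(F)\le|F^{ -1}(\beta)|\le\frac{p^n}{|\mathrm{Im}(F)|}+\Xi(F)$; $F$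 is almost balanced if $\Xi(F)\neq0$ and some $\beta$ attains one of these bounds with equality. -}

module Defs where

open import Data.Nat as ℕ using (ℕ; zero; suc; NonZero; _∸_)
open import Data.Nat.DivMod using (_mod_)
open import Data.Fin using (Fin; toℕ)
open import Data.Fin.Properties using () renaming (_≟_ to _≟ᶠ_)
open import Data.Integer as ℤ using (ℤ; +_; -[1+_])
open import Data.List as L using (List; []; _∷_; concatMap; allFin; foldr; filter; length)
open import Data.Vec as V using (Vec; []; _∷_; zipWith; replicate; toList)
open import Data.Vec.Properties using (≡-dec)
open import Data.Nat.ListAction using () renaming (sum to ℕsum)
open import Data.Product using (∃; Σ; _×_)
open import Data.Sum using (_⊎_)
open import Relation.Nullary using (¬_; ¬?)
open import Relation.Binary.PropositionalEquality using (_≡_; _≢_)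

module _ (p : ℕ) .{{_ : NonZero p}} where

  Fp : Set
  Fp = Fin p

  Fpⁿ : ℕ → Set
  Fpⁿ n = Vec Fp n

  zeroF : Fp
  zeroF = 0 mod p

  zeroVec : (n : ℕ) → Fpⁿ n
  zeroVec n = replicate n zeroF

  allVecs : (n : ℕ) → List (Fpⁿ n)
  allVecs zero = [] ∷ []
  allVecs (suc n) = concatMap (λ i → L.map (i ∷_) (allVecs n)) (allFin p)

  dotℕ : {n : ℕ} → Fpⁿ n → Fpⁿ n → ℕ
  dotℕ x y = ℕsum (toList (zipWith (λ a b → toℕ a ℕ.* toℕ b) x y))

  dot : {n : ℕ} → Fpⁿ n → Fpⁿ n → Fp
  dot x y = dotℕ x y mod p

  -- The cyclotomic integers Z[ζ_p], ζ_p = e^{2πi/p}.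
  -- An element is a coefficient vector u : Fin p → ℤ standing for
  -- Σ_k u k · ζ_p^k.  Since p is prime, Σ_k c_k ζ^k = 0 iff all c_k are
  -- equal, so two coefficient vectors denote the same complex number iff
  -- they differ by a constant vector; this is the equality _≈ᶜ_.
  Cyc : Set
  Cyc = Fin p → ℤ

  _≈ᶜ_ : Cyc → Cyc → Set
  u ≈ᶜ v = ∃ λ (c : ℤ) → ∀ k → u k ≡ v k ℤ.+ c

  sumFin : (Fin p → ℤ) → ℤ
  sumFin f = foldr (λ i acc → f i ℤ.+ acc) (+ 0) (allFin p)

  0ᶜ : Cyc
  0ᶜ _ = + 0

  intᶜ : ℤ → Cyc
  intᶜ c k with toℕ k
  ... | zero = c
  ... | suc _ = + 0

  ζ^ : ℕ → Cyc
  ζ^ e k with toℕ (e mod p) ℕ.≟ toℕ k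
  ... | Relation.Nullary.yes _ = + 1
  ... | Relation.Nullary.no _ = + 0

  _+ᶜ_ : Cyc → Cyc → Cyc
  (u +ᶜ v) k = u k ℤ.+ v k

  -- product (convolution, since ζ^p = 1)
  _*ᶜ_ : Cyc → Cyc → Cyc
  (u *ᶜ v) k = sumFin (λ i → u i ℤ.* v ((toℕ k ℕ.+ (p ∸ toℕ i)) mod p))

  conj : Cyc → Cyc
  conj u k = u ((p ∸ toℕ k) mod p)

  absSq : Cyc → Cyc
  absSq w = w *ᶜ conj w

  sumᶜ : {A : Set} → (A → Cyc) → List A → Cyc
  sumᶜ f xs = foldr (λ x acc → f x +ᶜ acc) 0ᶜ xs

  -- Walsh transform  W_f(a) = Σ_x ζ_p^{f(x) - <a,x>}
  -- (the exponent -<a,x> is represented by (p-1)·<a,x> modulo p)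
  walsh : {n : ℕ} → (Fpⁿ n → Fp) → Fpⁿ n → Cyc
  walsh {n} f a = sumᶜ (λ x → ζ^ (toℕ (f x) ℕ.+ (p ∸ 1) ℕ.* dotℕ a x)) (allVecs n)

  -- "|w|^2 = p^e" for an integer exponent e (e = n + s, s ∈ ℤ):
  -- for e ≥ 0 this is |w|^2 = p^e, for e < 0 it is p^{-e}|w|^2 = 1.
  AbsSqIsPow : Cyc → ℤ → Set
  AbsSqIsPow w (+ k) = absSq w ≈ᶜ intᶜ (+ (p ℕ.^ k))
  AbsSqIsPow w -[1+ k ] = (intᶜ (+ (p ℕ.^ suc k)) *ᶜ absSq w) ≈ᶜ intᶜ (+ 1)

  -- f is s-plateaued: |W_f(a)| ∈ {0, p^{(n+s)/2}} for all a,
  -- i.e. |W_f(a)|^2 ∈ {0, p^{n+s}}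
  IsPlateauedWith : {n : ℕ} → (Fpⁿ n → Fp) → ℤ → Set
  IsPlateauedWith {n} f s =
    ∀ a → (absSq (walsh f a) ≈ᶜ 0ᶜ) ⊎ AbsSqIsPow (walsh f a) (+ n ℤ.+ s)

  component : {n m : ℕ} → (Fpⁿ n → Fpⁿ m) → Fpⁿ m → Fpⁿ n → Fp
  component F b x = dot b (F x)

  walshF : {n m : ℕ} → (Fpⁿ n → Fpⁿ m) → Fpⁿ m → Fpⁿ n → Cyc
  walshF F b a = walsh (component F b) a

  IsPlateaued : {n m : ℕ} → (Fpⁿ n → Fpⁿ m) → Set
  IsPlateaued {n} {m} F =
    ∀ (b : Fpⁿ m) → b ≢ zeroVec m → ∃ λ (s : ℤ) → IsPlateauedWith (component F b) s

  IsTPlateaued : {n m : ℕ} → (Fpⁿ n → Fpⁿ m) → ℤ → Set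
  IsTPlateaued {n} {m} F t =
    ∀ (b : Fpⁿ m) → b ≢ zeroVec m → IsPlateauedWith (component F b) t

  Surjective : {n m : ℕ} → (Fpⁿ n → Fpⁿ m) → Set
  Surjective {n} {m} F = ∀ (β : Fpⁿ m) → ∃ λ x → F x ≡ β

  _≟ᵛ_ : {m : ℕ} → (x y : Fpⁿ m) → Relation.Nullary.Dec (x ≡ y)
  _≟ᵛ_ = ≡-dec _≟ᶠ_

  preimSize : {n m : ℕ} → (Fpⁿ n → Fpⁿ m) → Fpⁿ m → ℕ
  preimSize {n} F β = length (filter (λ x → F x ≟ᵛ β) (allVecs n))

  imSize : {n m : ℕ} → (Fpⁿ n → Fpⁿ m) → ℕ
  imSize {n} {m} F =
    length (filter (λ β → ¬? (preimSize F β ℕ.≟ 0)) (allVecs m))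

  -- p^m · N_F = Σ_{b ≠ 0} |W_F(b,0)|^2  (an element of Z[ζ_p])
  pmImbalance : {n m : ℕ} → (Fpⁿ n → Fpⁿ m) → Cyc
  pmImbalance {n} {m} F =
    sumᶜ (λ b → absSq (walshF F b (zeroVec n)))
         (filter (λ b → ¬? (b ≟ᵛ zeroVec m)) (allVecs m))

  -- p^m · |Im F|^2 · Ξ(F)^2
  --   = (|Im F| - 1)(|Im F| · p^m N_F - p^{2n}(p^m - |Im F|))
  XiSqScaled : {n m : ℕ} → (Fpⁿ n → Fpⁿ m) → Cyc
  XiSqScaled {n} {m} F =
    intᶜ (+ I ℤ.- + 1) *ᶜ
      ((intᶜ (+ I) *ᶜ pmImbalance F) +ᶜ
        intᶜ (ℤ.- (+ (p ℕ.^ (2 ℕ.* n)) ℤ.* (+ (p ℕ.^ m) ℤ.- + I))))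
    where I = imSize F

  -- Almost balanced: Ξ(F) ≠ 0 and some β has |F^{-1}(β)| = p^n/|Im F| ± Ξ(F),
  -- i.e. (|Im F|·|F^{-1}(β)| - p^n)^2 = |Im F|^2 Ξ(F)^2 (both sides ≥ 0);
  -- everything is multiplied by p^m to stay inside Z[ζ_p].
  AlmostBalanced : {n m : ℕ} → (Fpⁿ n → Fpⁿ m) → Set
  AlmostBalanced {n} {m} F =
    ¬ (XiSqScaled F ≈ᶜ 0ᶜ) ×
    ∃ λ (β : Fpⁿ m) →
      intᶜ (+ (p ℕ.^ m) ℤ.* (d β ℤ.* d β)) ≈ᶜ XiSqScaled F
    where d : Fpⁿ m → ℤ
          d β = + (imSize F ℕ.* preimSize F β) ℤ.- + (p ℕ.^ n)

-- The Walsh transform at a = 0 only sees the preimage sizes N β = |F⁻¹(β)|.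
-- Summing |W_F(b,0)|² over all b counts pairs of values lying on common
-- hyperplanes, so p^m N_F is δ₀ · (p^m Σ N² − p^{2n}) plus a constant in Z[ζ_p].
-- For surjective F the almost-balanced equation then says that the excess
-- E β = p^m N β − p^n satisfies p^m E(β₀)² = (p^m − 1) Σ E², while Σ E = 0:
-- the equality case of Cauchy–Schwarz, so E equals a constant c ≠ 0 off β₀.
-- Fibres of this shape give |W_F(b,0)|² = c² for every b ≠ 0, so all nonzero
-- components share the amplitude c² = p^{n+t}.  Hence n + t = 2j with |c| = p^j,
-- and since p^m divides c (as m ≤ n), m ≤ j.

module Submission where

open import Defs
open import Data.Empty using (⊥-elim)
open import Data.Fin using (Fin; toℕ; fromℕ<) renaming (zero to 0F; suc to sucF)
import Data.Fin.Properties as FinP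
open import Data.Integer as ℤ using (ℤ; +_; -[1+_]; _+_; _*_; _-_; -_; _≤_; ∣_∣)
open import Data.Integer.DivMod using (_/ℕ_; _%ℕ_; n%ℕd<d; a≡a%ℕn+[a/ℕn]*n)
import Data.Integer.Properties as ℤP
open import Data.Integer.Tactic.RingSolver using (solve-∀)
open import Data.List using (List; []; _∷_; foldr; filter; length; map; concatMap; concat; _++_; allFin)
open import Data.List.Properties using (map-tabulate; length-tabulate)
open import Data.Nat as ℕ using (ℕ; zero; suc; NonZero; _^_; _∸_; _%_; _/_)
open import Data.Nat.Coprimality using (Coprime; coprime⇒GCD≡1)
open import Data.Nat.Divisibility using (divides; ∣⇒≤) renaming (_∣_ to _∣ℕ_)
open import Data.Nat.DivMod using (_mod_; m≡m%n+[m/n]*n; m<n⇒m%n≡m; [m+kn]%n≡m%n; [m+n]%n≡m%n)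
open import Data.Nat.GCD using (module Bézout)
open import Data.Nat.Primality using (Prime; prime⇒irreducible; euclidsLemma)
import Data.Nat.Properties as ℕP
import Data.Nat.Tactic.RingSolver as ℕSolver
open import Data.Product using (∃; _×_; _,_; proj₁; proj₂)
open import Data.Sum using (inj₁; inj₂; reduce)
open import Data.Vec using ([]; _∷_)
import Data.Vec.Properties as VecP
open import Relation.Binary using (tri<; tri≈; tri>)
open import Relation.Binary.PropositionalEquality
open import Relation.Nullary using (Dec; yes; no; ¬_; ¬?)
open import Relation.Unary using (Decidable)

private variable
  A B : Set
  P Q : Set

∑ : List A → (A → ℤ) → ℤ
∑ xs f = foldr (λ x acc → f x + acc) (+ 0) xs

𝟙 : Dec P → ℤ
𝟙 (yes _) = + 1
𝟙 (no _) = + 0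

𝟙-cong : (P → Q) → (Q → P) → (a : Dec P) (b : Dec Q) → 𝟙 a ≡ 𝟙 b
𝟙-cong f g (yes _) (yes _) = refl
𝟙-cong f g (no _) (no _) = refl
𝟙-cong f g (yes a) (no b) = ⊥-elim (b (f a))
𝟙-cong f g (no a) (yes b) = ⊥-elim (a (g b))

𝟙-yes : P → (a : Dec P) → 𝟙 a ≡ + 1
𝟙-yes x (yes _) = refl
𝟙-yes x (no ¬x) = ⊥-elim (¬x x)

𝟙-no : ¬ P → (a : Dec P) → 𝟙 a ≡ + 0
𝟙-no ¬x (yes x) = ⊥-elim (¬x x)
𝟙-no ¬x (no _) = refl

𝟙-¬ : (a : Dec P) → 𝟙 (¬? a) ≡ + 1 - 𝟙 a
𝟙-¬ (yes _) = refl
𝟙-¬ (no _) = refl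

𝟙-nonneg : (a : Dec P) → + 0 ≤ 𝟙 a
𝟙-nonneg (yes _) = ℤ.+≤+ ℕ.z≤n
𝟙-nonneg (no _) = ℤ.+≤+ ℕ.z≤n

𝟙-mono : (P → Q) → (a : Dec P) (b : Dec Q) → 𝟙 a ≤ 𝟙 b
𝟙-mono f (yes x) (yes _) = ℤP.≤-refl
𝟙-mono f (yes x) (no ¬y) = ⊥-elim (¬y (f x))
𝟙-mono f (no _) b = 𝟙-nonneg b

𝟙*-≤ : (a : Dec P) (t : ℤ) → + 0 ≤ t → 𝟙 a * t ≤ t
𝟙*-≤ (yes _) t _ = ℤP.≤-reflexive (ℤP.*-identityˡ t)
𝟙*-≤ (no _) t 0≤t = 0≤t

𝟙*-nonneg : (a : Dec P) {t : ℤ} → + 0 ≤ t → + 0 ≤ 𝟙 a * t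
𝟙*-nonneg (yes _) {t} 0≤t = subst (+ 0 ≤_) (sym (ℤP.*-identityˡ t)) 0≤t
𝟙*-nonneg (no _) _ = ℤP.≤-refl

∑-cong : (xs : List A) {f g : A → ℤ} → (∀ x → f x ≡ g x) → ∑ xs f ≡ ∑ xs g
∑-cong [] e = refl
∑-cong (x ∷ xs) e = cong₂ _+_ (e x) (∑-cong xs e)

∑-+ : (xs : List A) (f g : A → ℤ) → ∑ xs (λ x → f x + g x) ≡ ∑ xs f + ∑ xs g
∑-+ [] f g = refl
∑-+ (x ∷ xs) f g rewrite ∑-+ xs f g = interchange (f x) (g x) (∑ xs f) (∑ xs g)
  where interchange : ∀ a b c d → a + b + (c + d) ≡ a + c + (b + d)
        interchange = solve-∀

∑-- : (xs : List A) (f g : A → ℤ) → ∑ xs (λ x → f x - g x) ≡ ∑ xs f - ∑ xs g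
∑-- [] f g = refl
∑-- (x ∷ xs) f g rewrite ∑-- xs f g = interchange (f x) (g x) (∑ xs f) (∑ xs g)
  where interchange : ∀ a b c d → a - b + (c - d) ≡ a + c - (b + d)
        interchange = solve-∀

∑-*ˡ : (xs : List A) (c : ℤ) (f : A → ℤ) → ∑ xs (λ x → c * f x) ≡ c * ∑ xs f
∑-*ˡ [] c f = sym (ℤP.*-zeroʳ c)
∑-*ˡ (x ∷ xs) c f rewrite ∑-*ˡ xs c f = sym (ℤP.*-distribˡ-+ c (f x) (∑ xs f))

∑-*ʳ : (xs : List A) (c : ℤ) (f : A → ℤ) → ∑ xs (λ x → f x * c) ≡ ∑ xs f * c
∑-*ʳ xs c f = trans (∑-cong xs (λ x → ℤP.*-comm (f x) c))
                (trans (∑-*ˡ xs c f) (ℤP.*-comm c (∑ xs f)))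

∑-const : (xs : List A) (c : ℤ) → ∑ xs (λ _ → c) ≡ + length xs * c
∑-const [] c = refl
∑-const (x ∷ xs) c rewrite ∑-const xs c = distrib (+ length xs) c
  where distrib : ∀ a c → c + a * c ≡ (+ 1 + a) * c
        distrib = solve-∀

∑-zero : (xs : List A) {f : A → ℤ} → (∀ x → f x ≡ + 0) → ∑ xs f ≡ + 0
∑-zero xs e = trans (∑-cong xs e) (trans (∑-const xs (+ 0)) (ℤP.*-zeroʳ (+ length xs)))

∑-swap : (xs : List A) (ys : List B) (f : A → B → ℤ) →
         ∑ xs (λ x → ∑ ys (f x)) ≡ ∑ ys (λ y → ∑ xs (λ x → f x y))
∑-swap [] ys f = sym (∑-zero ys (λ _ → refl))
∑-swap (x ∷ xs) ys f rewrite ∑-swap xs ys f = sym (∑-+ ys (f x) (λ y → ∑ xs (λ x → f x y)))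

∑-++ : (xs ys : List A) (f : A → ℤ) → ∑ (xs ++ ys) f ≡ ∑ xs f + ∑ ys f
∑-++ [] ys f = sym (ℤP.+-identityˡ _)
∑-++ (x ∷ xs) ys f rewrite ∑-++ xs ys f = sym (ℤP.+-assoc (f x) (∑ xs f) (∑ ys f))

∑-map : (g : A → B) (xs : List A) (f : B → ℤ) → ∑ (map g xs) f ≡ ∑ xs (λ x → f (g x))
∑-map g [] f = refl
∑-map g (x ∷ xs) f = cong (λ z → f (g x) + z) (∑-map g xs f)

∑-concatMap : (g : A → List B) (xs : List A) (f : B → ℤ) →
              ∑ (concatMap g xs) f ≡ ∑ xs (λ x → ∑ (g x) f)
∑-concatMap g [] f = refl
∑-concatMap g (x ∷ xs) f =
  trans (∑-++ (g x) (concat (map g xs)) f) (cong (λ z → ∑ (g x) f + z) (∑-concatMap g xs f))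

∑-mono-≤ : (xs : List A) {f g : A → ℤ} → (∀ x → f x ≤ g x) → ∑ xs f ≤ ∑ xs g
∑-mono-≤ [] e = ℤP.≤-refl
∑-mono-≤ (x ∷ xs) e = ℤP.+-mono-≤ (e x) (∑-mono-≤ xs e)

length-filter : {P : A → Set} (P? : Decidable P) (xs : List A) →
                + length (filter P? xs) ≡ ∑ xs (λ x → 𝟙 (P? x))
length-filter P? [] = refl
length-filter P? (x ∷ xs) with P? x
... | yes _ = cong (λ z → + 1 + z) (length-filter P? xs)
... | no _ = trans (length-filter P? xs) (sym (ℤP.+-identityˡ _))

∑-filter : {P : A → Set} (P? : Decidable P) (xs : List A) (f : A → ℤ) →
           ∑ (filter P? xs) f ≡ ∑ xs (λ x → 𝟙 (P? x) * f x)
∑-filter P? [] f = refl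
∑-filter P? (x ∷ xs) f with P? x
... | yes _ = cong₂ _+_ (sym (ℤP.*-identityˡ (f x))) (∑-filter P? xs f)
... | no _ = trans (∑-filter P? xs f) (sym (ℤP.+-identityˡ _))

∑-allFin-suc : ∀ n (f : Fin (suc n) → ℤ) → ∑ (allFin (suc n)) f ≡ f 0F + ∑ (allFin n) (λ i → f (sucF i))
∑-allFin-suc n f = begin
  ∑ (allFin (suc n)) f                    ≡⟨ cong (λ is → ∑ (0F ∷ is) f) (map-tabulate (λ i → i) sucF) ⟨
  f 0F + ∑ (map sucF (allFin n)) f        ≡⟨ cong (λ z → f 0F + z) (∑-map sucF (allFin n) f) ⟩
  f 0F + ∑ (allFin n) (λ i → f (sucF i))  ∎
  where open ≡-Reasoning

∑-δ-Fin : ∀ n (i₀ : Fin n) (h : Fin n → ℤ) → ∑ (allFin n) (λ i → 𝟙 (i FinP.≟ i₀) * h i) ≡ h i₀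
∑-δ-Fin (suc n) 0F h = begin
  ∑ (allFin (suc n)) (λ i → 𝟙 (i FinP.≟ 0F) * h i)  ≡⟨ ∑-allFin-suc n (λ i → 𝟙 (i FinP.≟ 0F) * h i) ⟩
  + 1 * h 0F + ∑ (allFin n) (λ i → + 0 * h (sucF i)) ≡⟨ cong (λ z → + 1 * h 0F + z) (∑-zero (allFin n) (λ _ → refl)) ⟩
  + 1 * h 0F + + 0                                  ≡⟨ trans (ℤP.+-identityʳ _) (ℤP.*-identityˡ (h 0F)) ⟩
  h 0F                                              ∎
  where open ≡-Reasoning
∑-δ-Fin (suc n) (sucF j) h = begin
  ∑ (allFin (suc n)) (λ i → 𝟙 (i FinP.≟ sucF j) * h i)
    ≡⟨ ∑-allFin-suc n (λ i → 𝟙 (i FinP.≟ sucF j) * h i) ⟩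
  + 0 * h 0F + ∑ (allFin n) (λ i → 𝟙 (sucF i FinP.≟ sucF j) * h (sucF i))
    ≡⟨ ℤP.+-identityˡ _ ⟩
  ∑ (allFin n) (λ i → 𝟙 (sucF i FinP.≟ sucF j) * h (sucF i))
    ≡⟨ ∑-cong (allFin n) (λ i → cong (_* h (sucF i)) (𝟙-cong FinP.suc-injective (cong sucF) (sucF i FinP.≟ sucF j) (i FinP.≟ j))) ⟩
  ∑ (allFin n) (λ i → 𝟙 (i FinP.≟ j) * h (sucF i))
    ≡⟨ ∑-δ-Fin n j (λ i → h (sucF i)) ⟩
  h (sucF j) ∎
  where open ≡-Reasoning

∑-δ-Fin′ : ∀ n (i₀ : Fin n) (h : Fin n → ℤ) → ∑ (allFin n) (λ i → 𝟙 (i₀ FinP.≟ i) * h i) ≡ h i₀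
∑-δ-Fin′ n i₀ h = trans (∑-cong (allFin n) (λ i → cong (_* h i) (𝟙-cong sym sym (i₀ FinP.≟ i) (i FinP.≟ i₀)))) (∑-δ-Fin n i₀ h)

module Congruence (p : ℕ) .{{_ : NonZero p}} where

  infix 4 _≡ₚ_

  record _≡ₚ_ (a b : ℤ) : Set where
    constructor _,_
    field
      quotient : ℤ
      difference : a - b ≡ quotient * + p

  ≡ₚ-refl : ∀ a → a ≡ₚ a
  ≡ₚ-refl a = + 0 , ℤP.+-inverseʳ a

  ≡ₚ-sym : ∀ {a b} → a ≡ₚ b → b ≡ₚ a
  ≡ₚ-sym {a} {b} (k , e) = - k , (begin
    b - a         ≡⟨ swap a b ⟩
    - (a - b)     ≡⟨ cong -_ e ⟩
    - (k * + p)   ≡⟨ ℤP.neg-distribˡ-* k (+ p) ⟩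
    - k * + p     ∎)
    where open ≡-Reasoning
          swap : ∀ a b → b - a ≡ - (a - b)
          swap = solve-∀

  ≡ₚ-+ : ∀ {a b c d} → a ≡ₚ b → c ≡ₚ d → a + c ≡ₚ b + d
  ≡ₚ-+ {a} {b} {c} {d} (k , e) (l , f) = k + l , (begin
    (a + c) - (b + d)      ≡⟨ regroup a b c d ⟩
    (a - b) + (c - d)      ≡⟨ cong₂ _+_ e f ⟩
    k * + p + l * + p      ≡⟨ ℤP.*-distribʳ-+ (+ p) k l ⟨
    (k + l) * + p          ∎)
    where open ≡-Reasoning
          regroup : ∀ a b c d → (a + c) - (b + d) ≡ (a - b) + (c - d)
          regroup = solve-∀

  ≡ₚ-trans : ∀ {a b c} → a ≡ₚ b → b ≡ₚ c → a ≡ₚ c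
  ≡ₚ-trans {a} {b} {c} (k , e) (l , f) = k + l , (begin
    a - c                  ≡⟨ telescope a b c ⟩
    (a - b) + (b - c)      ≡⟨ cong₂ _+_ e f ⟩
    k * + p + l * + p      ≡⟨ ℤP.*-distribʳ-+ (+ p) k l ⟨
    (k + l) * + p          ∎)
    where open ≡-Reasoning
          telescope : ∀ a b c → a - c ≡ (a - b) + (b - c)
          telescope = solve-∀

  ≡ₚ-neg : ∀ {a b} → a ≡ₚ b → - a ≡ₚ - b
  ≡ₚ-neg {a} {b} (k , e) = - k , (begin
    - a - - b      ≡⟨ factor a b ⟩
    - (a - b)      ≡⟨ cong -_ e ⟩
    - (k * + p)    ≡⟨ ℤP.neg-distribˡ-* k (+ p) ⟩
    - k * + p      ∎)
    where open ≡-Reasoning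
          factor : ∀ a b → - a - - b ≡ - (a - b)
          factor = solve-∀

  ≡ₚ-*ʳ : ∀ {a b} c → a ≡ₚ b → a * c ≡ₚ b * c
  ≡ₚ-*ʳ {a} {b} c (k , e) = k * c , (begin
    a * c - b * c    ≡⟨ factor a b c ⟩
    (a - b) * c      ≡⟨ cong (_* c) e ⟩
    k * + p * c      ≡⟨ swap k (+ p) c ⟩
    k * c * + p      ∎)
    where open ≡-Reasoning
          factor : ∀ a b c → a * c - b * c ≡ (a - b) * c
          factor = solve-∀
          swap : ∀ a b c → a * b * c ≡ a * c * b
          swap = solve-∀

  ≡ₚ-+ˡ : ∀ {a b} c → a ≡ₚ b → c + a ≡ₚ c + b
  ≡ₚ-+ˡ c = ≡ₚ-+ (≡ₚ-refl c)

  ≡ₚ-+ʳ : ∀ {a b} c → a ≡ₚ b → a + c ≡ₚ b + c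
  ≡ₚ-+ʳ c h = ≡ₚ-+ h (≡ₚ-refl c)

  ≡ₚ-resp : ∀ {a a′ b b′} → a ≡ a′ → b ≡ b′ → a ≡ₚ b → a′ ≡ₚ b′
  ≡ₚ-resp refl refl h = h

  ≡ₚ-cancelˡ : ∀ {d a b} → d + a ≡ₚ d + b → a ≡ₚ b
  ≡ₚ-cancelˡ {d} {a} {b} h = ≡ₚ-resp (cancel d a) (cancel d b) (≡ₚ-+ˡ (- d) h)
    where cancel : ∀ d a → - d + (d + a) ≡ a
          cancel = solve-∀

  toℕ-mod : ∀ x → toℕ (x mod p) ≡ x % p
  toℕ-mod x = FinP.toℕ-fromℕ< _

  mod-toℕ : (i : Fin p) → toℕ i mod p ≡ i
  mod-toℕ i = FinP.toℕ-injective (trans (toℕ-mod (toℕ i)) (m<n⇒m%n≡m (FinP.toℕ<n i)))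

  pos-∸ : ∀ m n → n ℕ.≤ m → + (m ∸ n) ≡ + m - + n
  pos-∸ m n n≤m = sym (trans (ℤP.[+m]-[+n]≡m⊖n m n) (ℤP.⊖-≥ n≤m))

  mod-≡⇒≡ₚ : ∀ x y → x mod p ≡ y mod p → + x ≡ₚ + y
  mod-≡⇒≡ₚ x y e = + (x / p) - + (y / p) , (begin
    + x - + y
      ≡⟨ cong₂ _-_ (divMod x) (divMod y) ⟩
    + (x % p) + + (x / p) * + p - (+ (y % p) + + (y / p) * + p)
      ≡⟨ cong (λ r → + r + + (x / p) * + p - (+ (y % p) + + (y / p) * + p)) x%p≡y%p ⟩
    + (y % p) + + (x / p) * + p - (+ (y % p) + + (y / p) * + p)
      ≡⟨ factor (+ (y % p)) (+ (x / p)) (+ (y / p)) (+ p) ⟩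
    (+ (x / p) - + (y / p)) * + p ∎)
    where
      open ≡-Reasoning
      x%p≡y%p : x % p ≡ y % p
      x%p≡y%p = trans (sym (toℕ-mod x)) (trans (cong toℕ e) (toℕ-mod y))
      divMod : ∀ x → + x ≡ + (x % p) + + (x / p) * + p
      divMod x = trans (cong +_ (m≡m%n+[m/n]*n x p))
                   (trans (ℤP.pos-+ (x % p) _) (cong (_+_ (+ (x % p))) (ℤP.pos-* (x / p) p)))
      factor : ∀ r a b p → r + a * p - (r + b * p) ≡ (a - b) * p
      factor = solve-∀

  mod-≡-of-multiple : ∀ x y k → + x - + y ≡ + k * + p → x mod p ≡ y mod p
  mod-≡-of-multiple x y k e = FinP.toℕ-injective (begin
    toℕ (x mod p)          ≡⟨ toℕ-mod x ⟩
    x % p                  ≡⟨ cong (_% p) x≡y+kp ⟩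
    (y ℕ.+ k ℕ.* p) % p    ≡⟨ [m+kn]%n≡m%n y k p ⟩
    y % p                  ≡⟨ toℕ-mod y ⟨
    toℕ (y mod p)          ∎)
    where
      open ≡-Reasoning
      split : ∀ a b → a ≡ b + (a - b)
      split = solve-∀
      x≡y+kp : x ≡ y ℕ.+ k ℕ.* p
      x≡y+kp = ℤP.+-injective (begin
        + x                   ≡⟨ split (+ x) (+ y) ⟩
        + y + (+ x - + y)     ≡⟨ cong (_+_ (+ y)) e ⟩
        + y + + k * + p       ≡⟨ cong (_+_ (+ y)) (ℤP.pos-* k p) ⟨
        + y + + (k ℕ.* p)     ≡⟨ ℤP.pos-+ y _ ⟨
        + (y ℕ.+ k ℕ.* p)     ∎)

  ≡ₚ⇒mod-≡ : ∀ x y → + x ≡ₚ + y → x mod p ≡ y mod p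
  ≡ₚ⇒mod-≡ x y (+ k , e) = mod-≡-of-multiple x y k e
  ≡ₚ⇒mod-≡ x y h@(-[1+ k ] , _) = sym (mod-≡-of-multiple y x (suc k) (_≡ₚ_.difference (≡ₚ-sym h)))

  toℕ-mod-≡ₚ : ∀ x → + toℕ (x mod p) ≡ₚ + x
  toℕ-mod-≡ₚ x = mod-≡⇒≡ₚ (toℕ (x mod p)) x (mod-toℕ (x mod p))

module PrimeField (q : ℕ) (p-prime : Prime (suc (suc q))) where

  p : ℕ
  p = suc (suc q)

  open Congruence p

  residue : ℤ → Fin p
  residue a = fromℕ< (n%ℕd<d a p)

  residue-≡ₚ : ∀ a → + toℕ (residue a) ≡ₚ a
  residue-≡ₚ a = ≡ₚ-resp (cong +_ (sym (FinP.toℕ-fromℕ< (n%ℕd<d a p)))) refl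
    (≡ₚ-sym (a /ℕ p , trans (cong (_- + (a %ℕ p)) (a≡a%ℕn+[a/ℕn]*n a p)) (cancel (+ (a %ℕ p)) ((a /ℕ p) * + p))))
    where cancel : ∀ a b → a + b - a ≡ b
          cancel = solve-∀

  ∣[+x]-[+y]∣<p : ∀ {x y} → x ℕ.< p → y ℕ.< p → ∣ + x - + y ∣ ℕ.< p
  ∣[+x]-[+y]∣<p {x} {y} x<p y<p = subst (ℕ._< p) (cong ∣_∣ (sym (ℤP.[+m]-[+n]≡m⊖n x y)))
    (ℕP.≤-<-trans (ℤP.∣m⊝n∣≤m⊔n x y) (ℕP.⊔-lub x<p y<p))

  ∣[+x]-[+y]∣≡0⇒x≡y : ∀ x y → ∣ + x - + y ∣ ≡ 0 → x ≡ y
  ∣[+x]-[+y]∣≡0⇒x≡y x y h = ℤP.+-injective (begin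
    + x              ≡⟨ split (+ x) (+ y) ⟩
    + y + (+ x - + y) ≡⟨ cong (_+_ (+ y)) (ℤP.∣i∣≡0⇒i≡0 {+ x - + y} h) ⟩
    + y + + 0        ≡⟨ ℤP.+-identityʳ (+ y) ⟩
    + y              ∎)
    where open ≡-Reasoning
          split : ∀ a b → a ≡ b + (a - b)
          split = solve-∀

  p∣∣x-y∣⇒x≡y : ∀ {x y} → x ℕ.< p → y ℕ.< p → p ∣ℕ ∣ + x - + y ∣ → x ≡ y
  p∣∣x-y∣⇒x≡y {x} {y} x<p y<p p∣ with ∣ + x - + y ∣ ℕ.≟ 0
  ... | yes ≡0 = ∣[+x]-[+y]∣≡0⇒x≡y x y ≡0
  ... | no ≢0 = ⊥-elim (ℕP.<⇒≱ (∣[+x]-[+y]∣<p x<p y<p) (∣⇒≤ ⦃ ℕ.≢-nonZero ≢0 ⦄ p∣))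

  coprime-to-p : ∀ a → 0 ℕ.< a → a ℕ.< p → Coprime a p
  coprime-to-p a 0<a a<p {d} (d∣a , d∣p) with prime⇒irreducible p-prime d∣p
  ... | inj₁ d≡1 = d≡1
  ... | inj₂ refl = ⊥-elim (ℕP.<⇒≱ a<p (∣⇒≤ ⦃ ℕ.>-nonZero 0<a ⦄ d∣a))

  inverse-ℕ : ∀ a → 0 ℕ.< a → a ℕ.< p → ∃ λ w → w * + a ≡ₚ + 1
  inverse-ℕ a 0<a a<p with Bézout.identity (coprime⇒GCD≡1 (coprime-to-p a 0<a a<p))
  ... | Bézout.Identity.+- x y 1+yp≡xa = + x , + y , (begin
        + x * + a - + 1            ≡⟨ cong (_- + 1) (ℤP.pos-* x a) ⟨
        + (x ℕ.* a) - + 1          ≡⟨ cong (λ z → + z - + 1) 1+yp≡xa ⟨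
        + (1 ℕ.+ y ℕ.* p) - + 1    ≡⟨ cong (_- + 1) (trans (ℤP.pos-+ 1 (y ℕ.* p)) (cong (_+_ (+ 1)) (ℤP.pos-* y p))) ⟩
        + 1 + + y * + p - + 1      ≡⟨ cancel (+ y * + p) ⟩
        + y * + p                  ∎)
    where open ≡-Reasoning
          cancel : ∀ b → + 1 + b - + 1 ≡ b
          cancel = solve-∀
  ... | Bézout.Identity.-+ x y 1+xa≡yp = - + x , - + y , (begin
        - + x * + a - + 1          ≡⟨ regroup (+ x) (+ a) ⟩
        - (+ 1 + + x * + a)        ≡⟨ cong (λ z → - (+ 1 + z)) (ℤP.pos-* x a) ⟨
        - (+ 1 + + (x ℕ.* a))      ≡⟨ cong -_ (ℤP.pos-+ 1 (x ℕ.* a)) ⟨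
        - + (1 ℕ.+ x ℕ.* a)        ≡⟨ cong (λ z → - + z) 1+xa≡yp ⟩
        - + (y ℕ.* p)              ≡⟨ cong -_ (ℤP.pos-* y p) ⟩
        - (+ y * + p)              ≡⟨ ℤP.neg-distribˡ-* (+ y) (+ p) ⟩
        - + y * + p                ∎)
    where open ≡-Reasoning
          regroup : ∀ x a → - x * a - + 1 ≡ - (+ 1 + x * a)
          regroup = solve-∀

  inverse : ∀ a → a ≢ + 0 → ∣ a ∣ ℕ.< p → ∃ λ w → w * a ≡ₚ + 1
  inverse (+ zero) a≢0 _ = ⊥-elim (a≢0 refl)
  inverse (+ suc n) _ a<p = inverse-ℕ (suc n) (ℕ.s≤s ℕ.z≤n) a<p
  inverse -[1+ n ] _ a<p with inverse-ℕ (suc n) (ℕ.s≤s ℕ.z≤n) a<p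
  ... | w , wa≡1 = - w , ≡ₚ-resp (sym (neg*neg w (+ suc n))) refl wa≡1
    where neg*neg : ∀ w a → - w * - a ≡ w * a
          neg*neg = solve-∀

  linear-solution : ∀ a T → a ≢ + 0 → ∣ a ∣ ℕ.< p → ∃ λ (i : Fin p) → + toℕ i * a ≡ₚ T
  linear-solution a T a≢0 a<p with inverse a a≢0 a<p
  ... | w , wa≡1 = residue (w * T) , ≡ₚ-trans (≡ₚ-*ʳ a (residue-≡ₚ (w * T)))
                     (≡ₚ-resp (swap w T a) (ℤP.*-identityˡ T) (≡ₚ-*ʳ T wa≡1))
    where swap : ∀ w T a → w * a * T ≡ w * T * a
          swap = solve-∀

  linear-solution-unique : ∀ a T → a ≢ + 0 → ∣ a ∣ ℕ.< p → (i j : Fin p) →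
                           + toℕ i * a ≡ₚ T → + toℕ j * a ≡ₚ T → i ≡ j
  linear-solution-unique a T a≢0 a<p i j ia≡T ja≡T with ≡ₚ-trans ia≡T (≡ₚ-sym ja≡T)
  ... | k , e = FinP.toℕ-injective (p∣∣x-y∣⇒x≡y (FinP.toℕ<n i) (FinP.toℕ<n j) p∣∣i-j∣)
    where
      factor : ∀ x y a → (x - y) * a ≡ x * a - y * a
      factor = solve-∀
      p∣∣i-j∣∣a∣ : p ∣ℕ ∣ + toℕ i - + toℕ j ∣ ℕ.* ∣ a ∣
      p∣∣i-j∣∣a∣ = divides ∣ k ∣ (begin
        ∣ + toℕ i - + toℕ j ∣ ℕ.* ∣ a ∣  ≡⟨ ℤP.abs-* (+ toℕ i - + toℕ j) a ⟨
        ∣ (+ toℕ i - + toℕ j) * a ∣      ≡⟨ cong ∣_∣ (trans (factor (+ toℕ i) (+ toℕ j) a) e) ⟩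
        ∣ k * + p ∣                      ≡⟨ ℤP.abs-* k (+ p) ⟩
        ∣ k ∣ ℕ.* p                      ∎)
        where open ≡-Reasoning
      p∣∣i-j∣ : p ∣ℕ ∣ + toℕ i - + toℕ j ∣
      p∣∣i-j∣ with euclidsLemma _ _ p-prime p∣∣i-j∣∣a∣
      ... | inj₁ h = h
      ... | inj₂ p∣∣a∣ = ⊥-elim (a≢0 (ℤP.∣i∣≡0⇒i≡0 (ℕP.n≤0⇒n≡0
                           (ℕP.≮⇒≥ (λ 0<∣a∣ → ℕP.<⇒≱ a<p (∣⇒≤ ⦃ ℕ.>-nonZero 0<∣a∣ ⦄ p∣∣a∣))))))

  linear-solution-count : ∀ a T → a ≢ + 0 → ∣ a ∣ ℕ.< p → {S : Fin p → Set} (S? : ∀ i → Dec (S i)) →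
                          (∀ i → S i → + toℕ i * a ≡ₚ T) → (∀ i → + toℕ i * a ≡ₚ T → S i) →
                          ∑ (allFin p) (λ i → 𝟙 (S? i)) ≡ + 1
  linear-solution-count a T a≢0 a<p {S} S? sound complete =
    trans (∑-cong (allFin p) (λ i → trans (𝟙-cong (only-i₀ i) (λ { refl → complete i i₀a≡T }) (S? i) (i FinP.≟ i₀))
                                          (sym (ℤP.*-identityʳ (𝟙 (i FinP.≟ i₀))))))
          (∑-δ-Fin p i₀ (λ _ → + 1))
    where
      i₀ : Fin p
      i₀ = proj₁ (linear-solution a T a≢0 a<p)
      i₀a≡T : + toℕ i₀ * a ≡ₚ T
      i₀a≡T = proj₂ (linear-solution a T a≢0 a<p)
      only-i₀ : ∀ i → S i → i ≡ i₀
      only-i₀ i Si = linear-solution-unique a T a≢0 a<p i i₀ (sound i Si) i₀a≡T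

  vectors : (m : ℕ) → List (Fpⁿ p m)
  vectors = allVecs p

  _≟ᵥ_ : ∀ {m} (x y : Fpⁿ p m) → Dec (x ≡ y)
  _≟ᵥ_ = _≟ᵛ_ p

  ∑-vectors-suc : ∀ m (f : Fpⁿ p (suc m) → ℤ) → ∑ (vectors (suc m)) f ≡ ∑ (allFin p) (λ i → ∑ (vectors m) (λ β → f (i ∷ β)))
  ∑-vectors-suc m f = trans (∑-concatMap (λ i → map (i ∷_) (vectors m)) (allFin p) f)
                            (∑-cong (allFin p) (λ i → ∑-map (i ∷_) (vectors m) f))

  ∑-vectors-const : ∀ m c → ∑ (vectors m) (λ _ → c) ≡ + (p ^ m) * c
  ∑-vectors-const zero c = trans (ℤP.+-identityʳ c) (sym (ℤP.*-identityˡ c))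
  ∑-vectors-const (suc m) c = begin
    ∑ (vectors (suc m)) (λ _ → c)                   ≡⟨ ∑-vectors-suc m (λ _ → c) ⟩
    ∑ (allFin p) (λ _ → ∑ (vectors m) (λ _ → c))    ≡⟨ ∑-cong (allFin p) (λ _ → ∑-vectors-const m c) ⟩
    ∑ (allFin p) (λ _ → + (p ^ m) * c)              ≡⟨ ∑-const (allFin p) _ ⟩
    + length (allFin p) * (+ (p ^ m) * c)           ≡⟨ cong (λ l → + l * (+ (p ^ m) * c)) (length-tabulate {n = p} (λ i → i)) ⟩
    + p * (+ (p ^ m) * c)                           ≡⟨ ℤP.*-assoc (+ p) (+ (p ^ m)) c ⟨
    + p * + (p ^ m) * c                             ≡⟨ cong (_* c) (ℤP.pos-* p (p ^ m)) ⟨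
    + (p ^ suc m) * c                               ∎
    where open ≡-Reasoning

  𝟙-∷ : ∀ {m} (i j : Fin p) (x y : Fpⁿ p m) → 𝟙 ((i ∷ x) ≟ᵥ (j ∷ y)) ≡ 𝟙 (i FinP.≟ j) * 𝟙 (x ≟ᵥ y)
  𝟙-∷ i j x y = split ((i ∷ x) ≟ᵥ (j ∷ y)) (i FinP.≟ j) (x ≟ᵥ y)
    where
      split : (d : Dec ((i ∷ x) ≡ (j ∷ y))) (a : Dec (i ≡ j)) (b : Dec (x ≡ y)) → 𝟙 d ≡ 𝟙 a * 𝟙 b
      split d (yes refl) (yes refl) = 𝟙-yes refl d
      split d (no i≢j) _ = 𝟙-no (λ e → i≢j (VecP.∷-injectiveˡ e)) d
      split d (yes _) (no x≢y) = 𝟙-no (λ e → x≢y (VecP.∷-injectiveʳ e)) d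

  ∑-δ-vectors : ∀ m (y : Fpⁿ p m) (h : Fpⁿ p m → ℤ) → ∑ (vectors m) (λ β → 𝟙 (β ≟ᵥ y) * h β) ≡ h y
  ∑-δ-vectors zero [] h = trans (ℤP.+-identityʳ _) (ℤP.*-identityˡ (h []))
  ∑-δ-vectors (suc m) (y ∷ ys) h = begin
    ∑ (vectors (suc m)) (λ β → 𝟙 (β ≟ᵥ (y ∷ ys)) * h β)
      ≡⟨ ∑-vectors-suc m (λ β → 𝟙 (β ≟ᵥ (y ∷ ys)) * h β) ⟩
    ∑ (allFin p) (λ i → ∑ (vectors m) (λ β → 𝟙 ((i ∷ β) ≟ᵥ (y ∷ ys)) * h (i ∷ β)))
      ≡⟨ ∑-cong (allFin p) (λ i → trans (∑-cong (vectors m) (λ β → trans (cong (_* h (i ∷ β)) (𝟙-∷ i y β ys)) (ℤP.*-assoc (𝟙 (i FinP.≟ y)) _ _)))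
                                         (∑-*ˡ (vectors m) (𝟙 (i FinP.≟ y)) (λ β → 𝟙 (β ≟ᵥ ys) * h (i ∷ β)))) ⟩
    ∑ (allFin p) (λ i → 𝟙 (i FinP.≟ y) * ∑ (vectors m) (λ β → 𝟙 (β ≟ᵥ ys) * h (i ∷ β)))
      ≡⟨ ∑-cong (allFin p) (λ i → cong (𝟙 (i FinP.≟ y) *_) (∑-δ-vectors m ys (λ β → h (i ∷ β)))) ⟩
    ∑ (allFin p) (λ i → 𝟙 (i FinP.≟ y) * h (i ∷ ys))
      ≡⟨ ∑-δ-Fin p y (λ i → h (i ∷ ys)) ⟩
    h (y ∷ ys) ∎
    where open ≡-Reasoning

  ∑-δ-vectors′ : ∀ m (y : Fpⁿ p m) (h : Fpⁿ p m → ℤ) → ∑ (vectors m) (λ β → 𝟙 (y ≟ᵥ β) * h β) ≡ h y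
  ∑-δ-vectors′ m y h = trans (∑-cong (vectors m) (λ β → cong (_* h β) (𝟙-cong sym sym (y ≟ᵥ β) (β ≟ᵥ y)))) (∑-δ-vectors m y h)

  dotℕ-comm : ∀ {m} (x y : Fpⁿ p m) → dotℕ p x y ≡ dotℕ p y x
  dotℕ-comm [] [] = refl
  dotℕ-comm (a ∷ x) (b ∷ y) = cong₂ ℕ._+_ (ℕP.*-comm (toℕ a) (toℕ b)) (dotℕ-comm x y)

  dotℕ-zeroˡ : ∀ {m} (x : Fpⁿ p m) → dotℕ p (zeroVec p m) x ≡ 0
  dotℕ-zeroˡ [] = refl
  dotℕ-zeroˡ (a ∷ x) = dotℕ-zeroˡ x

  dotℕ-zeroʳ : ∀ {m} (x : Fpⁿ p m) → dotℕ p x (zeroVec p m) ≡ 0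
  dotℕ-zeroʳ x = trans (dotℕ-comm x _) (dotℕ-zeroˡ x)

  ∑-exceptional : ∀ {m} A D (β₀ : Fpⁿ p m) (g : Fpⁿ p m → ℤ) →
                  ∑ (vectors m) (λ β → (A - D * 𝟙 (β ≟ᵥ β₀)) * g β) ≡ A * ∑ (vectors m) g - D * g β₀
  ∑-exceptional {m} A D β₀ g = begin
    ∑ (vectors m) (λ β → (A - D * 𝟙 (β ≟ᵥ β₀)) * g β)
      ≡⟨ ∑-cong (vectors m) (λ β → distrib A D (𝟙 (β ≟ᵥ β₀)) (g β)) ⟩
    ∑ (vectors m) (λ β → A * g β - D * (𝟙 (β ≟ᵥ β₀) * g β))
      ≡⟨ ∑-- (vectors m) (λ β → A * g β) (λ β → D * (𝟙 (β ≟ᵥ β₀) * g β)) ⟩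
    ∑ (vectors m) (λ β → A * g β) - ∑ (vectors m) (λ β → D * (𝟙 (β ≟ᵥ β₀) * g β))
      ≡⟨ cong₂ _-_ (∑-*ˡ (vectors m) A g) (trans (∑-*ˡ (vectors m) D _) (cong (D *_) (∑-δ-vectors m β₀ g))) ⟩
    A * ∑ (vectors m) g - D * g β₀ ∎
    where open ≡-Reasoning
          distrib : ∀ A D d x → (A - D * d) * x ≡ A * x - D * (d * x)
          distrib = solve-∀

  +-cancelˡ-mod : ∀ d x y → (d ℕ.+ x) mod p ≡ (d ℕ.+ y) mod p → x mod p ≡ y mod p
  +-cancelˡ-mod d x y h = ≡ₚ⇒mod-≡ x y (≡ₚ-cancelˡ {+ d} (≡ₚ-resp (ℤP.pos-+ d x) (ℤP.pos-+ d y) (mod-≡⇒≡ₚ _ _ h)))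

  +-congˡ-mod : ∀ d x y → x mod p ≡ y mod p → (d ℕ.+ x) mod p ≡ (d ℕ.+ y) mod p
  +-congˡ-mod d x y h = ≡ₚ⇒mod-≡ _ _ (≡ₚ-resp (sym (ℤP.pos-+ d x)) (sym (ℤP.pos-+ d y)) (≡ₚ-+ˡ (+ d) (mod-≡⇒≡ₚ x y h)))

  δₚ : ℕ → ℕ → ℤ
  δₚ x y = 𝟙 ((x mod p) FinP.≟ (y mod p))

  δₚ-+ˡ : ∀ d x y → δₚ (d ℕ.+ x) (d ℕ.+ y) ≡ δₚ x y
  δₚ-+ˡ d x y = 𝟙-cong (+-cancelˡ-mod d x y) (+-congˡ-mod d x y) _ _

  solutions : ∀ m (u v : Fpⁿ p m) (c₁ c₂ : ℕ) → ℤ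
  solutions m u v c₁ c₂ = ∑ (vectors m) (λ b → δₚ (dotℕ p b u ℕ.+ c₁) (dotℕ p b v ℕ.+ c₂))

  solutions-diagonal : ∀ m (u : Fpⁿ p m) c₁ c₂ → solutions m u u c₁ c₂ ≡ + (p ^ m) * δₚ c₁ c₂
  solutions-diagonal m u c₁ c₂ =
    trans (∑-cong (vectors m) (λ b → δₚ-+ˡ (dotℕ p b u) c₁ c₂)) (∑-vectors-const m (δₚ c₁ c₂))

  solutions-suc : ∀ m u₁ (u : Fpⁿ p m) v₁ v c₁ c₂ → solutions (suc m) (u₁ ∷ u) (v₁ ∷ v) c₁ c₂ ≡
                  ∑ (allFin p) (λ i → solutions m u v (toℕ i ℕ.* toℕ u₁ ℕ.+ c₁) (toℕ i ℕ.* toℕ v₁ ℕ.+ c₂))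
  solutions-suc m u₁ u v₁ v c₁ c₂ =
    trans (∑-vectors-suc m (λ b → δₚ (dotℕ p b (u₁ ∷ u) ℕ.+ c₁) (dotℕ p b (v₁ ∷ v) ℕ.+ c₂)))
          (∑-cong (allFin p) (λ i → ∑-cong (vectors m) (λ b →
             cong₂ δₚ (reassoc (toℕ i ℕ.* toℕ u₁) (dotℕ p b u) c₁) (reassoc (toℕ i ℕ.* toℕ v₁) (dotℕ p b v) c₂))))
    where reassoc : ∀ a b c → a ℕ.+ b ℕ.+ c ≡ b ℕ.+ (a ℕ.+ c)
          reassoc = ℕSolver.solve-∀

  solutions-in-one-coordinate : ∀ (u₁ v₁ : Fin p) c₁ c₂ → u₁ ≢ v₁ →
    ∑ (allFin p) (λ i → δₚ (toℕ i ℕ.* toℕ u₁ ℕ.+ c₁) (toℕ i ℕ.* toℕ v₁ ℕ.+ c₂)) ≡ + 1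
  solutions-in-one-coordinate u₁ v₁ c₁ c₂ u₁≢v₁ =
    linear-solution-count a T a≢0 (∣[+x]-[+y]∣<p (FinP.toℕ<n u₁) (FinP.toℕ<n v₁)) (λ i → _ FinP.≟ _) sound complete
    where
      a = + toℕ u₁ - + toℕ v₁
      T = + c₂ - + c₁
      a≢0 : a ≢ + 0
      a≢0 a≡0 = u₁≢v₁ (FinP.toℕ-injective (∣[+x]-[+y]∣≡0⇒x≡y _ _ (cong ∣_∣ a≡0)))
      pos-*-+ : ∀ i u c → + (i ℕ.* u ℕ.+ c) ≡ + i * + u + + c
      pos-*-+ i u c = trans (ℤP.pos-+ (i ℕ.* u) c) (cong (_+ + c) (ℤP.pos-* i u))
      sound : ∀ i → (toℕ i ℕ.* toℕ u₁ ℕ.+ c₁) mod p ≡ (toℕ i ℕ.* toℕ v₁ ℕ.+ c₂) mod p → + toℕ i * a ≡ₚ T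
      sound i h = ≡ₚ-resp (move-lhs (+ toℕ i) (+ toℕ u₁) (+ toℕ v₁) (+ c₁)) (move-rhs (+ toℕ i) (+ toℕ v₁) (+ c₁) (+ c₂))
        (≡ₚ-+ʳ (- (+ toℕ i * + toℕ v₁ + + c₁))
          (≡ₚ-resp (pos-*-+ (toℕ i) (toℕ u₁) c₁) (pos-*-+ (toℕ i) (toℕ v₁) c₂) (mod-≡⇒≡ₚ _ _ h)))
        where move-lhs : ∀ i u v c₁ → i * u + c₁ - (i * v + c₁) ≡ i * (u - v)
              move-lhs = solve-∀
              move-rhs : ∀ i v c₁ c₂ → i * v + c₂ - (i * v + c₁) ≡ c₂ - c₁
              move-rhs = solve-∀
      complete : ∀ i → + toℕ i * a ≡ₚ T → (toℕ i ℕ.* toℕ u₁ ℕ.+ c₁) mod p ≡ (toℕ i ℕ.* toℕ v₁ ℕ.+ c₂) mod p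
      complete i h = ≡ₚ⇒mod-≡ _ _ (≡ₚ-resp (trans (move-lhs (+ toℕ i) (+ toℕ u₁) (+ toℕ v₁) (+ c₁)) (sym (pos-*-+ (toℕ i) (toℕ u₁) c₁)))
                                           (trans (move-rhs (+ toℕ i) (+ toℕ v₁) (+ c₁) (+ c₂)) (sym (pos-*-+ (toℕ i) (toℕ v₁) c₂)))
        (≡ₚ-+ʳ (+ toℕ i * + toℕ v₁ + + c₁) h))
        where move-lhs : ∀ i u v c₁ → i * (u - v) + (i * v + c₁) ≡ i * u + c₁
              move-lhs = solve-∀
              move-rhs : ∀ i v c₁ c₂ → c₂ - c₁ + (i * v + c₁) ≡ i * v + c₂
              move-rhs = solve-∀

  solutions-off-diagonal : ∀ m (u v : Fpⁿ p (suc m)) c₁ c₂ → u ≢ v → solutions (suc m) u v c₁ c₂ ≡ + (p ^ m)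
  solutions-off-diagonal m (u₁ ∷ u) (v₁ ∷ v) c₁ c₂ u≢v with u ≟ᵥ v
  ... | yes refl = begin
    solutions (suc m) (u₁ ∷ u) (v₁ ∷ u) c₁ c₂
      ≡⟨ solutions-suc m u₁ u v₁ u c₁ c₂ ⟩
    ∑ (allFin p) (λ i → solutions m u u (toℕ i ℕ.* toℕ u₁ ℕ.+ c₁) (toℕ i ℕ.* toℕ v₁ ℕ.+ c₂))
      ≡⟨ ∑-cong (allFin p) (λ i → solutions-diagonal m u _ _) ⟩
    ∑ (allFin p) (λ i → + (p ^ m) * δₚ (toℕ i ℕ.* toℕ u₁ ℕ.+ c₁) (toℕ i ℕ.* toℕ v₁ ℕ.+ c₂))
      ≡⟨ ∑-*ˡ (allFin p) (+ (p ^ m)) (λ i → δₚ (toℕ i ℕ.* toℕ u₁ ℕ.+ c₁) (toℕ i ℕ.* toℕ v₁ ℕ.+ c₂)) ⟩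
    + (p ^ m) * ∑ (allFin p) (λ i → δₚ (toℕ i ℕ.* toℕ u₁ ℕ.+ c₁) (toℕ i ℕ.* toℕ v₁ ℕ.+ c₂))
      ≡⟨ cong (+ (p ^ m) *_) (solutions-in-one-coordinate u₁ v₁ c₁ c₂ (λ e → u≢v (cong (_∷ u) e))) ⟩
    + (p ^ m) * + 1
      ≡⟨ ℤP.*-identityʳ _ ⟩
    + (p ^ m) ∎
    where open ≡-Reasoning
  solutions-off-diagonal zero (u₁ ∷ []) (v₁ ∷ []) c₁ c₂ u≢v | no []≢[] = ⊥-elim ([]≢[] refl)
  solutions-off-diagonal (suc m) (u₁ ∷ u) (v₁ ∷ v) c₁ c₂ u≢v | no u≢v′ = begin
    solutions (suc (suc m)) (u₁ ∷ u) (v₁ ∷ v) c₁ c₂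
      ≡⟨ solutions-suc (suc m) u₁ u v₁ v c₁ c₂ ⟩
    ∑ (allFin p) (λ i → solutions (suc m) u v (toℕ i ℕ.* toℕ u₁ ℕ.+ c₁) (toℕ i ℕ.* toℕ v₁ ℕ.+ c₂))
      ≡⟨ ∑-cong (allFin p) (λ i → solutions-off-diagonal m u v _ _ u≢v′) ⟩
    ∑ (allFin p) (λ i → + (p ^ m))
      ≡⟨ ∑-const (allFin p) (+ (p ^ m)) ⟩
    + length (allFin p) * + (p ^ m)
      ≡⟨ cong (λ l → + l * + (p ^ m)) (length-tabulate {n = p} (λ i → i)) ⟩
    + p * + (p ^ m)
      ≡⟨ ℤP.pos-* p (p ^ m) ⟨
    + (p ^ suc m) ∎
    where open ≡-Reasoning

  1<p : 1 ℕ.< p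
  1<p = ℕ.s≤s (ℕ.s≤s ℕ.z≤n)

  ^-monoʳ-< : ∀ {a b} → a ℕ.< b → p ^ a ℕ.< p ^ b
  ^-monoʳ-< = ℕP.^-monoʳ-< p 1<p

  ^-injectiveʳ : ∀ a b → p ^ a ≡ p ^ b → a ≡ b
  ^-injectiveʳ a b e with ℕP.<-cmp a b
  ... | tri< a<b _ _ = ⊥-elim (ℕP.<-irrefl e (^-monoʳ-< a<b))
  ... | tri≈ _ a≡b _ = a≡b
  ... | tri> _ _ a>b = ⊥-elim (ℕP.<-irrefl (sym e) (^-monoʳ-< a>b))

  ^-cancelʳ-≤ : ∀ a b → p ^ a ℕ.≤ p ^ b → a ℕ.≤ b
  ^-cancelʳ-≤ a b le = ℕP.≮⇒≥ (λ b<a → ℕP.<⇒≱ (^-monoʳ-< b<a) le)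

  square≡^⇒even : ∀ k x → x ℕ.* x ≡ p ^ k → ∃ λ j → (k ≡ j ℕ.+ j) × (x ≡ p ^ j)
  square≡^⇒even zero x e = 0 , refl , ℕP.m*n≡1⇒m≡1 x x e
  square≡^⇒even (suc zero) x e with prime⇒irreducible p-prime (divides x (sym (trans e (ℕP.*-identityʳ p))))
  ... | inj₁ refl = ⊥-elim (ℕP.<-irrefl e (ℕ.s≤s (ℕ.s≤s ℕ.z≤n)))
  ... | inj₂ refl = ⊥-elim (ℕP.<-irrefl (sym (ℕP.*-cancelˡ-≡ p 1 p e)) 1<p)
  square≡^⇒even (suc (suc k)) x e = descend (reduce (euclidsLemma x x p-prime p∣x²))
    where
      p∣x² : p ∣ℕ x ℕ.* x
      p∣x² = divides (p ℕ.* p ^ k) (trans e (ℕP.*-comm p (p ℕ.* p ^ k)))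
      regroup : ∀ y p → p ℕ.* (p ℕ.* (y ℕ.* y)) ≡ y ℕ.* p ℕ.* (y ℕ.* p)
      regroup = ℕSolver.solve-∀
      descend : p ∣ℕ x → ∃ λ j → (suc (suc k) ≡ j ℕ.+ j) × (x ≡ p ^ j)
      descend (divides y refl) with square≡^⇒even k y
        (ℕP.*-cancelˡ-≡ (y ℕ.* y) (p ^ k) p (ℕP.*-cancelˡ-≡ (p ℕ.* (y ℕ.* y)) (p ℕ.* p ^ k) p (trans (regroup y p) e)))
      ... | j , refl , refl = suc j , cong suc (sym (ℕP.+-suc j j)) , ℕP.*-comm (p ^ j) p

  i*i≡+∣i∣² : ∀ i → i * i ≡ + (∣ i ∣ ℕ.* ∣ i ∣)
  i*i≡+∣i∣² (+ n) = sym (ℤP.pos-* n n)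
  i*i≡+∣i∣² -[1+ n ] = trans (neg*neg (+ suc n)) (sym (ℤP.pos-* (suc n) (suc n)))
    where neg*neg : ∀ a → - a * - a ≡ a * a
          neg*neg = solve-∀

  ≈ᶜ-sym : ∀ {u v} → _≈ᶜ_ p u v → _≈ᶜ_ p v u
  ≈ᶜ-sym {u} {v} (c , f) = - c , λ k → trans (cancel (v k) c) (cong (_+ - c) (sym (f k)))
    where cancel : ∀ a c → a ≡ a + c + - c
          cancel = solve-∀

  ≈ᶜ-trans : ∀ {u v w} → _≈ᶜ_ p u v → _≈ᶜ_ p v w → _≈ᶜ_ p u w
  ≈ᶜ-trans {u} {v} {w} (c , f) (d , g) = d + c , λ k → trans (f k) (trans (cong (_+ c) (g k)) (ℤP.+-assoc (w k) d c))

  0ᶜ≈intᶜ0 : _≈ᶜ_ p (0ᶜ p) (intᶜ p (+ 0))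
  0ᶜ≈intᶜ0 = + 0 , λ { 0F → refl ; (sucF k) → refl }

  intᶜ-injective : ∀ a b → _≈ᶜ_ p (intᶜ p a) (intᶜ p b) → a ≡ b
  intᶜ-injective a b (c , f) = trans (f 0F) (trans (cong (_+_ b) c≡0) (ℤP.+-identityʳ b))
    where c≡0 : c ≡ + 0
          c≡0 = sym (trans (f (sucF 0F)) (ℤP.+-identityˡ c))

  intᶜ-*ᶜ : ∀ a (u : Cyc p) k → _*ᶜ_ p (intᶜ p a) u k ≡ a * u k
  intᶜ-*ᶜ a u k = trans (∑-allFin-suc (suc q) (λ i → intᶜ p a i * u ((toℕ k ℕ.+ (p ∸ toℕ i)) mod p)))
     (trans (cong₂ _+_ (cong (λ i → a * u i) k+p≡k) (∑-zero (allFin (suc q)) (λ i → refl))) (ℤP.+-identityʳ _))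
    where k+p≡k : (toℕ k ℕ.+ p) mod p ≡ k
          k+p≡k = FinP.toℕ-injective (trans (toℕ-mod (toℕ k ℕ.+ p)) (trans ([m+n]%n≡m%n (toℕ k) p) (m<n⇒m%n≡m (FinP.toℕ<n k))))

  AbsSqIsPow-int : ∀ (w : Cyc p) z K → AbsSqIsPow p w z → _≈ᶜ_ p (absSq p w) (intᶜ p (+ K)) → K ≢ 0 →
                   ∃ λ k → (z ≡ + k) × (K ≡ p ^ k)
  AbsSqIsPow-int w (+ k) K |w|²≈pᵏ |w|²≈K _ =
    k , refl , ℤP.+-injective (intᶜ-injective (+ K) (+ (p ^ k))
      (≈ᶜ-trans {intᶜ p (+ K)} {absSq p w} {intᶜ p (+ (p ^ k))} (≈ᶜ-sym {absSq p w} {intᶜ p (+ K)} |w|²≈K) |w|²≈pᵏ))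
  AbsSqIsPow-int w -[1+ k ] K (c , f) (d , g) K≢0 = ⊥-elim (ℕP.<-irrefl (sym aK≡1) 1<aK)
    where
      a = p ^ suc k
      aK≈1 : _≈ᶜ_ p (intᶜ p (+ (a ℕ.* K))) (intᶜ p (+ 1))
      aK≈1 = c - + a * d , λ j → begin
         intᶜ p (+ (a ℕ.* K)) j                          ≡⟨ intᶜ-pos-* j ⟩
         + a * intᶜ p (+ K) j                            ≡⟨ shift (+ a) (intᶜ p (+ K) j) d ⟩
         + a * (intᶜ p (+ K) j + d) - + a * d            ≡⟨ cong (λ z → + a * z - + a * d) (g j) ⟨
         + a * absSq p w j - + a * d                     ≡⟨ cong (_- + a * d) (intᶜ-*ᶜ (+ a) (absSq p w) j) ⟨
         _*ᶜ_ p (intᶜ p (+ a)) (absSq p w) j - + a * d   ≡⟨ cong (_- + a * d) (f j) ⟩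
         intᶜ p (+ 1) j + c - + a * d                    ≡⟨ ℤP.+-assoc (intᶜ p (+ 1) j) c (- (+ a * d)) ⟩
         intᶜ p (+ 1) j + (c - + a * d)                  ∎
        where open ≡-Reasoning
              shift : ∀ a x d → a * x ≡ a * (x + d) - a * d
              shift = solve-∀
              intᶜ-pos-* : ∀ j → intᶜ p (+ (a ℕ.* K)) j ≡ + a * intᶜ p (+ K) j
              intᶜ-pos-* 0F = ℤP.pos-* a K
              intᶜ-pos-* (sucF j) = sym (ℤP.*-zeroʳ (+ a))
      aK≡1 : a ℕ.* K ≡ 1
      aK≡1 = ℤP.+-injective (intᶜ-injective (+ (a ℕ.* K)) (+ 1) aK≈1)
      1<aK : 1 ℕ.< a ℕ.* K
      1<aK = ℕP.<-≤-trans (ℕP.<-≤-trans 1<p (ℕP.m≤m*n p (p ^ k) ⦃ ℕP.m^n≢0 p k ⦄)) (ℕP.m≤m*n a K ⦃ ℕ.≢-nonZero K≢0 ⦄)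

  sumᶜ-coef : (g : A → Cyc p) (xs : List A) (k : Fin p) → sumᶜ p g xs k ≡ ∑ xs (λ x → g x k)
  sumᶜ-coef g [] k = refl
  sumᶜ-coef g (x ∷ xs) k = cong (_+_ (g x k)) (sumᶜ-coef g xs k)

  ζ^-coef : ∀ e k → ζ^ p e k ≡ 𝟙 ((e mod p) FinP.≟ k)
  ζ^-coef e k with toℕ (e mod p) ℕ.≟ toℕ k | (e mod p) FinP.≟ k
  ... | yes _ | yes _ = refl
  ... | no _ | no _ = refl
  ... | yes e≡k | no e≢k = ⊥-elim (e≢k (FinP.toℕ-injective e≡k))
  ... | no e≢k | yes e≡k = ⊥-elim (e≢k (cong toℕ e≡k))

  -- absSq w j pairs w i with w (conj-index i j), and conj-index i j = i − j (conj-index-δₚ)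
  conj-index : Fin p → Fin p → Fin p
  conj-index i j = (p ∸ toℕ ((toℕ j ℕ.+ (p ∸ toℕ i)) mod p)) mod p

  absSq-coef : ∀ (w : Cyc p) j → absSq p w j ≡ ∑ (allFin p) (λ i → w i * w (conj-index i j))
  absSq-coef w j = refl

  conj-index-δₚ : ∀ x y j → 𝟙 ((y mod p) FinP.≟ conj-index (x mod p) j) ≡ δₚ x (y ℕ.+ toℕ j)
  conj-index-δₚ x y j = 𝟙-cong to from _ _
    where
      t = toℕ (x mod p)
      s = toℕ ((toℕ j ℕ.+ (p ∸ t)) mod p)
      s≡ₚ : + s ≡ₚ + toℕ j + (+ p - + t)
      s≡ₚ = ≡ₚ-resp refl (trans (ℤP.pos-+ (toℕ j) (p ∸ t)) (cong (_+_ (+ toℕ j)) (pos-∸ p t (FinP.toℕ≤n (x mod p)))))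
                    (toℕ-mod-≡ₚ (toℕ j ℕ.+ (p ∸ t)))
      p-s≡x-j : + (p ∸ s) ≡ₚ + x - + toℕ j
      p-s≡x-j = ≡ₚ-resp (sym (pos-∸ p s (FinP.toℕ≤n ((toℕ j ℕ.+ (p ∸ t)) mod p)))) refl
        (≡ₚ-trans (≡ₚ-+ˡ (+ p) (≡ₚ-neg s≡ₚ))
          (≡ₚ-resp (sym (simplify (+ p) (+ toℕ j) (+ t))) refl (≡ₚ-+ʳ (- + toℕ j) (toℕ-mod-≡ₚ x))))
        where simplify : ∀ p j t → p + - (j + (p - t)) ≡ t - j
              simplify = solve-∀
      cancel : ∀ a b → a - b + b ≡ a
      cancel = solve-∀
      cancel′ : ∀ a b → a + b - b ≡ a
      cancel′ = solve-∀
      to : y mod p ≡ conj-index (x mod p) j → x mod p ≡ (y ℕ.+ toℕ j) mod p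
      to h = ≡ₚ⇒mod-≡ x (y ℕ.+ toℕ j) (≡ₚ-sym (≡ₚ-resp (sym (ℤP.pos-+ y (toℕ j))) (cancel (+ x) (+ toℕ j))
               (≡ₚ-+ʳ (+ toℕ j) (≡ₚ-trans (mod-≡⇒≡ₚ y (p ∸ s) h) p-s≡x-j))))
      from : x mod p ≡ (y ℕ.+ toℕ j) mod p → y mod p ≡ conj-index (x mod p) j
      from h = ≡ₚ⇒mod-≡ y (p ∸ s) (≡ₚ-trans
                 (≡ₚ-sym (≡ₚ-resp refl (cancel′ (+ y) (+ toℕ j))
                   (≡ₚ-+ʳ (- + toℕ j) (≡ₚ-resp refl (ℤP.pos-+ y (toℕ j)) (mod-≡⇒≡ₚ x (y ℕ.+ toℕ j) h)))))
                 (≡ₚ-sym p-s≡x-j))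

  square-nonneg : ∀ i → + 0 ≤ i * i
  square-nonneg i = subst (+ 0 ≤_) (sym (i*i≡+∣i∣² i)) (ℤ.+≤+ ℕ.z≤n)

  square≤0⇒0 : ∀ i → i * i ≤ + 0 → i ≡ + 0
  square≤0⇒0 i i²≤0 = reduce (ℤP.i*j≡0⇒i≡0∨j≡0 i (ℤP.≤-antisym i²≤0 (square-nonneg i)))

  term≤∑ : ∀ {m} (f : Fpⁿ p m → ℤ) → (∀ β → + 0 ≤ f β) → ∀ y → f y ≤ ∑ (vectors m) f
  term≤∑ {m} f f≥0 y = subst (_≤ ∑ (vectors m) f) (∑-δ-vectors m y f)
    (∑-mono-≤ (vectors m) (λ β → 𝟙*-≤ (β ≟ᵥ y) (f β) (f≥0 β)))

  -- g β = (p^m − 1) E β + E β₀ has Σ g² = g(β₀)², so g vanishes off β₀.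
  cauchy-schwarz-equality : ∀ {m} (E : Fpⁿ p m → ℤ) (β₀ : Fpⁿ p m) → ∑ (vectors m) E ≡ + 0 →
    + (p ^ m) * (E β₀ * E β₀) ≡ (+ (p ^ m) - + 1) * ∑ (vectors m) (λ β → E β * E β) →
    ∀ β → β ≢ β₀ → (+ (p ^ m) - + 1) * E β + E β₀ ≡ + 0
  cauchy-schwarz-equality {m} E β₀ ∑E≡0 extremal β β≢β₀ = square≤0⇒0 (g β) (begin
    g β * g β                  ≡⟨ trans (cong (_* (g β * g β)) (𝟙-yes β≢β₀ (¬? (β ≟ᵥ β₀)))) (ℤP.*-identityˡ (g β * g β)) ⟨
    off-β₀ β                   ≤⟨ term≤∑ off-β₀ (λ γ → 𝟙*-nonneg (¬? (γ ≟ᵥ β₀)) (square-nonneg (g γ))) β ⟩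
    ∑ (vectors m) off-β₀       ≡⟨ ∑-off-β₀ ⟩
    + 0                        ∎)
    where
      open ℤP.≤-Reasoning
      M = + (p ^ m)
      g : Fpⁿ p m → ℤ
      g γ = (M - + 1) * E γ + E β₀
      off-β₀ : Fpⁿ p m → ℤ
      off-β₀ γ = 𝟙 (¬? (γ ≟ᵥ β₀)) * (g γ * g γ)
      ∑g² : ∑ (vectors m) (λ γ → g γ * g γ) ≡ g β₀ * g β₀
      ∑g² = begin-equality
        ∑ (vectors m) (λ γ → g γ * g γ)
          ≡⟨ ∑-cong (vectors m) (λ γ → expand M (E γ) (E β₀)) ⟩
        ∑ (vectors m) (λ γ → ((M - + 1) * (M - + 1)) * (E γ * E γ) + (+ 2 * (M - + 1) * E β₀) * E γ + E β₀ * E β₀)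
          ≡⟨ ∑-+ (vectors m) (λ γ → ((M - + 1) * (M - + 1)) * (E γ * E γ) + (+ 2 * (M - + 1) * E β₀) * E γ) (λ _ → E β₀ * E β₀) ⟩
        ∑ (vectors m) (λ γ → ((M - + 1) * (M - + 1)) * (E γ * E γ) + (+ 2 * (M - + 1) * E β₀) * E γ) + ∑ (vectors m) (λ _ → E β₀ * E β₀)
          ≡⟨ cong₂ _+_ (trans (∑-+ (vectors m) (λ γ → ((M - + 1) * (M - + 1)) * (E γ * E γ)) (λ γ → (+ 2 * (M - + 1) * E β₀) * E γ))
                             (cong₂ _+_ (∑-*ˡ (vectors m) ((M - + 1) * (M - + 1)) (λ γ → E γ * E γ))
                                        (trans (∑-*ˡ (vectors m) (+ 2 * (M - + 1) * E β₀) E) (cong ((+ 2 * (M - + 1) * E β₀) *_) ∑E≡0))))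
                       (∑-vectors-const m (E β₀ * E β₀)) ⟩
        ((M - + 1) * (M - + 1)) * ∑ (vectors m) (λ γ → E γ * E γ) + (+ 2 * (M - + 1) * E β₀) * + 0 + M * (E β₀ * E β₀)
          ≡⟨ regroup M (∑ (vectors m) (λ γ → E γ * E γ)) (E β₀) ⟩
        (M - + 1) * ((M - + 1) * ∑ (vectors m) (λ γ → E γ * E γ)) + M * (E β₀ * E β₀)
          ≡⟨ cong (λ z → (M - + 1) * z + M * (E β₀ * E β₀)) extremal ⟨
        (M - + 1) * (M * (E β₀ * E β₀)) + M * (E β₀ * E β₀)
          ≡⟨ collapse M (E β₀) ⟩
        g β₀ * g β₀ ∎
        where
          expand : ∀ M e e₀ → ((M - + 1) * e + e₀) * ((M - + 1) * e + e₀) ≡ ((M - + 1) * (M - + 1)) * (e * e) + (+ 2 * (M - + 1) * e₀) * e + e₀ * e₀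
          expand = solve-∀
          regroup : ∀ M S e₀ → ((M - + 1) * (M - + 1)) * S + (+ 2 * (M - + 1) * e₀) * + 0 + M * (e₀ * e₀) ≡ (M - + 1) * ((M - + 1) * S) + M * (e₀ * e₀)
          regroup = solve-∀
          collapse : ∀ M e₀ → (M - + 1) * (M * (e₀ * e₀)) + M * (e₀ * e₀) ≡ ((M - + 1) * e₀ + e₀) * ((M - + 1) * e₀ + e₀)
          collapse = solve-∀
      ∑-off-β₀ : ∑ (vectors m) off-β₀ ≡ + 0
      ∑-off-β₀ = begin-equality
        ∑ (vectors m) off-β₀
          ≡⟨ ∑-cong (vectors m) (λ γ → trans (cong (_* (g γ * g γ)) (𝟙-¬ (γ ≟ᵥ β₀))) (complement (𝟙 (γ ≟ᵥ β₀)) (g γ * g γ))) ⟩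
        ∑ (vectors m) (λ γ → g γ * g γ - 𝟙 (γ ≟ᵥ β₀) * (g γ * g γ))
          ≡⟨ ∑-- (vectors m) (λ γ → g γ * g γ) (λ γ → 𝟙 (γ ≟ᵥ β₀) * (g γ * g γ)) ⟩
        ∑ (vectors m) (λ γ → g γ * g γ) - ∑ (vectors m) (λ γ → 𝟙 (γ ≟ᵥ β₀) * (g γ * g γ))
          ≡⟨ cong₂ _-_ ∑g² (∑-δ-vectors m β₀ (λ γ → g γ * g γ)) ⟩
        g β₀ * g β₀ - g β₀ * g β₀
          ≡⟨ ℤP.+-inverseʳ (g β₀ * g β₀) ⟩
        + 0 ∎
        where complement : ∀ i t → (+ 1 - i) * t ≡ t - i * t
              complement = solve-∀

  plateau-amplitude : ∀ {n} (f : Fpⁿ p n → Fp p) (s : ℤ) (K : ℕ) → K ≢ 0 →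
    _≈ᶜ_ p (absSq p (walsh p f (zeroVec p n))) (intᶜ p (+ K)) → IsPlateauedWith p f s →
    ∃ λ k → (+ n + s ≡ + k) × (K ≡ p ^ k)
  plateau-amplitude {n} f s K K≢0 |W|²≈K plateaued with plateaued (zeroVec p n)
  ... | inj₁ |W|²≈0 = ⊥-elim (K≢0 (ℤP.+-injective (intᶜ-injective (+ K) (+ 0)
          (≈ᶜ-trans {intᶜ p (+ K)} {absSq p W} {intᶜ p (+ 0)} (≈ᶜ-sym {absSq p W} {intᶜ p (+ K)} |W|²≈K)
            (≈ᶜ-trans {absSq p W} {0ᶜ p} {intᶜ p (+ 0)} |W|²≈0 0ᶜ≈intᶜ0)))))
    where W = walsh p f (zeroVec p n)
  ... | inj₂ |W|²≈pⁿ⁺ˢ = AbsSqIsPow-int (walsh p f (zeroVec p n)) (+ n + s) K |W|²≈pⁿ⁺ˢ |W|²≈K K≢0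

  module ValueDistribution (n m : ℕ) (F : Fpⁿ p n → Fpⁿ p m) where

    #F⁻¹ : Fpⁿ p m → ℤ
    #F⁻¹ β = ∑ (vectors n) (λ x → 𝟙 (F x ≟ᵥ β))

    preimSize≡#F⁻¹ : ∀ β → + preimSize p F β ≡ #F⁻¹ β
    preimSize≡#F⁻¹ β = length-filter (λ x → F x ≟ᵥ β) (vectors n)

    walsh-zero-coef : ∀ b k → walshF p F b (zeroVec p n) k ≡ ∑ (vectors n) (λ x → 𝟙 (dot p b (F x) FinP.≟ k))
    walsh-zero-coef b k = begin
      walshF p F b (zeroVec p n) k
        ≡⟨ sumᶜ-coef (λ x → ζ^ p (exponent x)) (vectors n) k ⟩
      ∑ (vectors n) (λ x → ζ^ p (exponent x) k)
        ≡⟨ ∑-cong (vectors n) (λ x → trans (ζ^-coef (exponent x) k) (cong (λ e → 𝟙 (e FinP.≟ k)) (exponent-mod x))) ⟩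
      ∑ (vectors n) (λ x → 𝟙 (dot p b (F x) FinP.≟ k)) ∎
      where
        open ≡-Reasoning
        exponent : Fpⁿ p n → ℕ
        exponent x = toℕ (dot p b (F x)) ℕ.+ (p ∸ 1) ℕ.* dotℕ p (zeroVec p n) x
        exponent-mod : ∀ x → exponent x mod p ≡ dot p b (F x)
        exponent-mod x = begin
          exponent x mod p                                 ≡⟨ cong (λ d → (toℕ (dot p b (F x)) ℕ.+ (p ∸ 1) ℕ.* d) mod p) (dotℕ-zeroˡ x) ⟩
          (toℕ (dot p b (F x)) ℕ.+ (p ∸ 1) ℕ.* 0) mod p    ≡⟨ cong (_mod p) (trans (cong (toℕ (dot p b (F x)) ℕ.+_) (ℕP.*-zeroʳ (p ∸ 1))) (ℕP.+-identityʳ _)) ⟩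
          toℕ (dot p b (F x)) mod p                        ≡⟨ mod-toℕ (dot p b (F x)) ⟩
          dot p b (F x)                                    ∎

    fibreWalsh : Fpⁿ p m → Fin p → ℤ
    fibreWalsh b k = ∑ (vectors m) (λ β → #F⁻¹ β * 𝟙 (dot p b β FinP.≟ k))

    walsh-zero≡fibreWalsh : ∀ b k → walshF p F b (zeroVec p n) k ≡ fibreWalsh b k
    walsh-zero≡fibreWalsh b k = begin
      walshF p F b (zeroVec p n) k                                    ≡⟨ walsh-zero-coef b k ⟩
      ∑ (vectors n) (λ x → h (F x))                                   ≡⟨ ∑-cong (vectors n) (λ x → ∑-δ-vectors′ m (F x) h) ⟨
      ∑ (vectors n) (λ x → ∑ (vectors m) (λ β → 𝟙 (F x ≟ᵥ β) * h β))  ≡⟨ ∑-swap (vectors n) (vectors m) (λ x β → 𝟙 (F x ≟ᵥ β) * h β) ⟩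
      ∑ (vectors m) (λ β → ∑ (vectors n) (λ x → 𝟙 (F x ≟ᵥ β) * h β))  ≡⟨ ∑-cong (vectors m) (λ β → ∑-*ʳ (vectors n) (h β) (λ x → 𝟙 (F x ≟ᵥ β))) ⟩
      fibreWalsh b k                                                  ∎
      where open ≡-Reasoning
            h : Fpⁿ p m → ℤ
            h β = 𝟙 (dot p b β FinP.≟ k)

    correlation : Fpⁿ p m → Fin p → ℤ
    correlation b j = ∑ (vectors m) (λ β → #F⁻¹ β * ∑ (vectors m) (λ γ → #F⁻¹ γ * δₚ (dotℕ p b β) (dotℕ p b γ ℕ.+ toℕ j)))

    absSq-walsh-zero : ∀ b j → absSq p (walshF p F b (zeroVec p n)) j ≡ correlation b j
    absSq-walsh-zero b j = begin
      absSq p w j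
        ≡⟨ absSq-coef w j ⟩
      ∑ (allFin p) (λ i → w i * w (conj-index i j))
        ≡⟨ ∑-cong (allFin p) (λ i → cong₂ _*_ (walsh-zero≡fibreWalsh b i) (walsh-zero≡fibreWalsh b (conj-index i j))) ⟩
      ∑ (allFin p) (λ i → fibreWalsh b i * W′ i)
        ≡⟨ ∑-cong (allFin p) (λ i → ∑-*ʳ (vectors m) (W′ i) (λ β → #F⁻¹ β * 𝟙 (dot p b β FinP.≟ i))) ⟨
      ∑ (allFin p) (λ i → ∑ (vectors m) (λ β → #F⁻¹ β * 𝟙 (dot p b β FinP.≟ i) * W′ i))
        ≡⟨ ∑-swap (allFin p) (vectors m) (λ i β → #F⁻¹ β * 𝟙 (dot p b β FinP.≟ i) * W′ i) ⟩
      ∑ (vectors m) (λ β → ∑ (allFin p) (λ i → #F⁻¹ β * 𝟙 (dot p b β FinP.≟ i) * W′ i))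
        ≡⟨ ∑-cong (vectors m) (λ β → trans (∑-cong (allFin p) (λ i → ℤP.*-assoc (#F⁻¹ β) _ _))
                                           (∑-*ˡ (allFin p) (#F⁻¹ β) (λ i → 𝟙 (dot p b β FinP.≟ i) * W′ i))) ⟩
      ∑ (vectors m) (λ β → #F⁻¹ β * ∑ (allFin p) (λ i → 𝟙 (dot p b β FinP.≟ i) * W′ i))
        ≡⟨ ∑-cong (vectors m) (λ β → cong (#F⁻¹ β *_) (∑-δ-Fin′ p (dot p b β) W′)) ⟩
      ∑ (vectors m) (λ β → #F⁻¹ β * W′ (dot p b β))
        ≡⟨ ∑-cong (vectors m) (λ β → cong (#F⁻¹ β *_) (∑-cong (vectors m) (λ γ → cong (#F⁻¹ γ *_) (conj-index-δₚ (dotℕ p b β) (dotℕ p b γ) j)))) ⟩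
      correlation b j ∎
      where open ≡-Reasoning
            w = walshF p F b (zeroVec p n)
            W′ : Fin p → ℤ
            W′ i = fibreWalsh b (conj-index i j)

    #F⁻¹≥1 : Surjective p F → ∀ β → + 1 ≤ #F⁻¹ β
    #F⁻¹≥1 surj β with surj β
    ... | x₀ , Fx₀≡β = subst (_≤ #F⁻¹ β) (∑-δ-vectors n x₀ (λ _ → + 1))
       (∑-mono-≤ (vectors n) (λ x → subst (_≤ 𝟙 (F x ≟ᵥ β)) (sym (ℤP.*-identityʳ (𝟙 (x ≟ᵥ x₀))))
          (𝟙-mono (λ { refl → Fx₀≡β }) (x ≟ᵥ x₀) (F x ≟ᵥ β))))

    imSize-surjective : Surjective p F → imSize p F ≡ p ^ m
    imSize-surjective surj = ℤP.+-injective (begin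
      + imSize p F                                        ≡⟨ length-filter (λ β → ¬? (preimSize p F β ℕ.≟ 0)) (vectors m) ⟩
      ∑ (vectors m) (λ β → 𝟙 (¬? (preimSize p F β ℕ.≟ 0))) ≡⟨ ∑-cong (vectors m) (λ β → 𝟙-yes (preimSize≢0 β) (¬? (preimSize p F β ℕ.≟ 0))) ⟩
      ∑ (vectors m) (λ _ → + 1)                           ≡⟨ trans (∑-vectors-const m (+ 1)) (ℤP.*-identityʳ _) ⟩
      + (p ^ m)                                           ∎)
      where open ≡-Reasoning
            preimSize≢0 : ∀ β → preimSize p F β ≢ 0
            preimSize≢0 β e = ℤP.<⇒≱ (ℤ.+<+ (ℕ.s≤s ℕ.z≤n)) (subst (+ 1 ≤_) (trans (sym (preimSize≡#F⁻¹ β)) (cong +_ e)) (#F⁻¹≥1 surj β))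

    ∑#F⁻¹≡pⁿ : ∑ (vectors m) #F⁻¹ ≡ + (p ^ n)
    ∑#F⁻¹≡pⁿ = begin
      ∑ (vectors m) #F⁻¹                                          ≡⟨ ∑-swap (vectors m) (vectors n) (λ β x → 𝟙 (F x ≟ᵥ β)) ⟩
      ∑ (vectors n) (λ x → ∑ (vectors m) (λ β → 𝟙 (F x ≟ᵥ β)))    ≡⟨ ∑-cong (vectors n) (λ x → trans (∑-cong (vectors m) (λ β → sym (ℤP.*-identityʳ (𝟙 (F x ≟ᵥ β)))))
                                                                                      (∑-δ-vectors′ m (F x) (λ _ → + 1))) ⟩
      ∑ (vectors n) (λ _ → + 1)                                   ≡⟨ trans (∑-vectors-const n (+ 1)) (ℤP.*-identityʳ _) ⟩
      + (p ^ n)                                                   ∎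
      where open ≡-Reasoning

    XiSqScaled-surjective : Surjective p F → ∀ k → XiSqScaled p F k ≡ (+ (p ^ m) - + 1) * (+ (p ^ m) * pmImbalance p F k)
    XiSqScaled-surjective surj k = begin
      XiSqScaled p F k
        ≡⟨ intᶜ-*ᶜ (+ I - + 1) (_+ᶜ_ p (_*ᶜ_ p (intᶜ p (+ I)) (pmImbalance p F)) (intᶜ p (- (+ (p ^ (2 ℕ.* n)) * (+ (p ^ m) - + I))))) k ⟩
      (+ I - + 1) * (_*ᶜ_ p (intᶜ p (+ I)) (pmImbalance p F) k + intᶜ p (- (+ (p ^ (2 ℕ.* n)) * (+ (p ^ m) - + I))) k)
        ≡⟨ cong (λ z → (+ I - + 1) * (z + intᶜ p (- (+ (p ^ (2 ℕ.* n)) * (+ (p ^ m) - + I))) k)) (intᶜ-*ᶜ (+ I) (pmImbalance p F) k) ⟩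
      (+ I - + 1) * (+ I * pmImbalance p F k + intᶜ p (- (+ (p ^ (2 ℕ.* n)) * (+ (p ^ m) - + I))) k)
        ≡⟨ cong (λ I → (+ I - + 1) * (+ I * pmImbalance p F k + intᶜ p (- (+ (p ^ (2 ℕ.* n)) * (+ (p ^ m) - + I))) k)) (imSize-surjective surj) ⟩
      (+ (p ^ m) - + 1) * (+ (p ^ m) * pmImbalance p F k + intᶜ p (- (+ (p ^ (2 ℕ.* n)) * (+ (p ^ m) - + (p ^ m)))) k)
        ≡⟨ cong (λ z → (+ (p ^ m) - + 1) * (+ (p ^ m) * pmImbalance p F k + intᶜ p z k)) (vanish (+ (p ^ (2 ℕ.* n))) (+ (p ^ m))) ⟩
      (+ (p ^ m) - + 1) * (+ (p ^ m) * pmImbalance p F k + intᶜ p (+ 0) k)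
        ≡⟨ cong (λ z → (+ (p ^ m) - + 1) * (+ (p ^ m) * pmImbalance p F k + z)) (intᶜ0-coef k) ⟩
      (+ (p ^ m) - + 1) * (+ (p ^ m) * pmImbalance p F k + + 0)
        ≡⟨ cong ((+ (p ^ m) - + 1) *_) (ℤP.+-identityʳ _) ⟩
      (+ (p ^ m) - + 1) * (+ (p ^ m) * pmImbalance p F k) ∎
      where open ≡-Reasoning
            I = imSize p F
            vanish : ∀ a b → - (a * (b - b)) ≡ + 0
            vanish = solve-∀
            intᶜ0-coef : ∀ k → intᶜ p (+ 0) k ≡ + 0
            intᶜ0-coef 0F = refl
            intᶜ0-coef (sucF k) = refl

    m≤n : Surjective p F → m ℕ.≤ n
    m≤n surj = ^-cancelʳ-≤ m n (ℤP.drop‿+≤+ (subst₂ _≤_ (trans (∑-vectors-const m (+ 1)) (ℤP.*-identityʳ (+ (p ^ m)))) ∑#F⁻¹≡pⁿ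
                                                       (∑-mono-≤ (vectors m) (#F⁻¹≥1 surj))))

  δ₀ : Fin p → ℤ
  δ₀ j = δₚ 0 (toℕ j)

  δ₀-1 : δ₀ (sucF 0F) ≡ + 0
  δ₀-1 = 𝟙-no (λ h → FinP.0≢1+n (trans h (mod-toℕ (sucF 0F)))) ((0 mod p) FinP.≟ (1 mod p))

  intᶜ-coef : ∀ a j → intᶜ p a j ≡ a * δ₀ j
  intᶜ-coef a 0F = sym (ℤP.*-identityʳ a)
  intᶜ-coef a (sucF j) = sym (trans (cong (a *_) (𝟙-no (λ h → FinP.0≢1+n (trans h (mod-toℕ (sucF j))))
                                                        ((0 mod p) FinP.≟ (toℕ (sucF j) mod p))))
                                    (ℤP.*-zeroʳ a))

  δₚ-self : ∀ x j → δₚ x (x ℕ.+ toℕ j) ≡ δ₀ j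
  δₚ-self x j = trans (cong (λ z → δₚ z (x ℕ.+ toℕ j)) (sym (ℕP.+-identityʳ x))) (δₚ-+ˡ x 0 (toℕ j))

  other : Fin p → Fin p
  other 0F = sucF 0F
  other (sucF _) = 0F

  other-≢ : ∀ i → other i ≢ i
  other-≢ 0F ()
  other-≢ (sucF _) ()

  another : ∀ {m} → Fpⁿ p (suc m) → Fpⁿ p (suc m)
  another (i ∷ x) = other i ∷ x

  another-≢ : ∀ {m} (x : Fpⁿ p (suc m)) → another x ≢ x
  another-≢ (i ∷ x) e = other-≢ i (VecP.∷-injectiveˡ e)

  module NonTrivialCodomain (n m′ : ℕ) (F : Fpⁿ p n → Fpⁿ p (suc m′)) where

    m = suc m′
    open ValueDistribution n m F

    pᵐ pᵐ⁻¹ pⁿ : ℕ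
    pᵐ = p ^ m
    pᵐ⁻¹ = p ^ m′
    pⁿ = p ^ n

    instance
      pᵐ≢0 : ℤ.NonZero (+ pᵐ)
      pᵐ≢0 = ℕP.m^n≢0 p m

      pᵐ-1≢0 : ℤ.NonZero (+ pᵐ - + 1)
      pᵐ-1≢0 = ℤ.≢-nonZero {+ pᵐ - + 1} (λ pᵐ-1≡0 → ℕP.<-irrefl (sym (ℤP.+-injective (trans (split (+ pᵐ)) (cong (_+ + 1) pᵐ-1≡0)))) 1<pᵐ)
        where split : ∀ a → a ≡ a - + 1 + + 1
              split = solve-∀
              1<pᵐ : 1 ℕ.< pᵐ
              1<pᵐ = ℕP.<-≤-trans 1<p (ℕP.m≤m*n p pᵐ⁻¹ ⦃ ℕP.m^n≢0 p m′ ⦄)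

    S₁ S₂ : ℤ
    S₁ = ∑ (vectors m) #F⁻¹
    S₂ = ∑ (vectors m) (λ β → #F⁻¹ β * #F⁻¹ β)

    -- pmImbalance-coef: p^m N_F = δ₀ · spread + offset
    spread offset : ℤ
    spread = + pᵐ * S₂ - S₁ * S₁
    offset = + pᵐ⁻¹ * (S₁ * S₁) - + pᵐ⁻¹ * S₂

    hyperplane-sizeʳ : ∀ b → b ≢ zeroVec p m → ∀ c j → ∑ (vectors m) (λ γ → δₚ c (dotℕ p b γ ℕ.+ j)) ≡ + pᵐ⁻¹
    hyperplane-sizeʳ b b≢0 c j =
      trans (∑-cong (vectors m) (λ γ → cong₂ δₚ (cong (ℕ._+ c) (sym (dotℕ-zeroʳ γ))) (cong (ℕ._+ j) (dotℕ-comm b γ))))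
            (solutions-off-diagonal m′ (zeroVec p m) b c j (λ e → b≢0 (sym e)))

    hyperplane-sizeˡ : ∀ b → b ≢ zeroVec p m → ∀ c → ∑ (vectors m) (λ β → δₚ (dotℕ p b β) c) ≡ + pᵐ⁻¹
    hyperplane-sizeˡ b b≢0 c =
      trans (∑-cong (vectors m) (λ β → cong₂ δₚ (trans (dotℕ-comm b β) (sym (ℕP.+-identityʳ (dotℕ p β b)))) (cong (ℕ._+ c) (sym (dotℕ-zeroʳ β)))))
            (solutions-off-diagonal m′ b (zeroVec p m) 0 c b≢0)

    solutions-split : ∀ β γ j → solutions m β γ 0 (toℕ j) ≡ 𝟙 (β ≟ᵥ γ) * (+ pᵐ * δ₀ j - + pᵐ⁻¹) + + pᵐ⁻¹
    solutions-split β γ j with β ≟ᵥ γ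
    ... | yes refl = trans (solutions-diagonal m β 0 (toℕ j)) (regroup (+ pᵐ * δ₀ j) (+ pᵐ⁻¹))
      where regroup : ∀ a b → a ≡ + 1 * (a - b) + b
            regroup = solve-∀
    ... | no β≢γ = trans (solutions-off-diagonal m′ β γ 0 (toℕ j) β≢γ) (sym (ℤP.+-identityˡ (+ pᵐ⁻¹)))

    ∑-correlation : ∀ j → ∑ (vectors m) (λ b → correlation b j) ≡ (+ pᵐ * δ₀ j - + pᵐ⁻¹) * S₂ + + pᵐ⁻¹ * (S₁ * S₁)
    ∑-correlation j = begin
      ∑ (vectors m) (λ b → correlation b j)
        ≡⟨ ∑-swap (vectors m) (vectors m) (λ b β → #F⁻¹ β * ∑ (vectors m) (λ γ → #F⁻¹ γ * k b β γ)) ⟩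
      ∑ (vectors m) (λ β → ∑ (vectors m) (λ b → #F⁻¹ β * ∑ (vectors m) (λ γ → #F⁻¹ γ * k b β γ)))
        ≡⟨ ∑-cong (vectors m) (λ β → ∑-*ˡ (vectors m) (#F⁻¹ β) (λ b → ∑ (vectors m) (λ γ → #F⁻¹ γ * k b β γ))) ⟩
      ∑ (vectors m) (λ β → #F⁻¹ β * ∑ (vectors m) (λ b → ∑ (vectors m) (λ γ → #F⁻¹ γ * k b β γ)))
        ≡⟨ ∑-cong (vectors m) (λ β → cong (#F⁻¹ β *_) (∑-swap (vectors m) (vectors m) (λ b γ → #F⁻¹ γ * k b β γ))) ⟩
      ∑ (vectors m) (λ β → #F⁻¹ β * ∑ (vectors m) (λ γ → ∑ (vectors m) (λ b → #F⁻¹ γ * k b β γ)))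
        ≡⟨ ∑-cong (vectors m) (λ β → cong (#F⁻¹ β *_) (∑-cong (vectors m) (λ γ → trans (∑-*ˡ (vectors m) (#F⁻¹ γ) (λ b → k b β γ))
              (cong (#F⁻¹ γ *_) (trans (∑-cong (vectors m) (λ b → cong (λ z → δₚ z (dotℕ p b γ ℕ.+ toℕ j)) (sym (ℕP.+-identityʳ (dotℕ p b β)))))
                                       (solutions-split β γ j)))))) ⟩
      ∑ (vectors m) (λ β → #F⁻¹ β * ∑ (vectors m) (λ γ → #F⁻¹ γ * (𝟙 (β ≟ᵥ γ) * a + + pᵐ⁻¹)))
        ≡⟨ ∑-cong (vectors m) (λ β → cong (#F⁻¹ β *_) (row β)) ⟩
      ∑ (vectors m) (λ β → #F⁻¹ β * (#F⁻¹ β * a + S₁ * + pᵐ⁻¹))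
        ≡⟨ ∑-cong (vectors m) (λ β → distrib (#F⁻¹ β) a (S₁ * + pᵐ⁻¹)) ⟩
      ∑ (vectors m) (λ β → (#F⁻¹ β * #F⁻¹ β) * a + #F⁻¹ β * (S₁ * + pᵐ⁻¹))
        ≡⟨ ∑-+ (vectors m) (λ β → (#F⁻¹ β * #F⁻¹ β) * a) (λ β → #F⁻¹ β * (S₁ * + pᵐ⁻¹)) ⟩
      ∑ (vectors m) (λ β → (#F⁻¹ β * #F⁻¹ β) * a) + ∑ (vectors m) (λ β → #F⁻¹ β * (S₁ * + pᵐ⁻¹))
        ≡⟨ cong₂ _+_ (∑-*ʳ (vectors m) a (λ β → #F⁻¹ β * #F⁻¹ β)) (∑-*ʳ (vectors m) (S₁ * + pᵐ⁻¹) #F⁻¹) ⟩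
      S₂ * a + S₁ * (S₁ * + pᵐ⁻¹)
        ≡⟨ regroup S₂ a S₁ (+ pᵐ⁻¹) ⟩
      a * S₂ + + pᵐ⁻¹ * (S₁ * S₁) ∎
      where
        open ≡-Reasoning
        a = + pᵐ * δ₀ j - + pᵐ⁻¹
        k : Fpⁿ p m → Fpⁿ p m → Fpⁿ p m → ℤ
        k b β γ = δₚ (dotℕ p b β) (dotℕ p b γ ℕ.+ toℕ j)
        distrib : ∀ n a c → n * (n * a + c) ≡ (n * n) * a + n * c
        distrib = solve-∀
        regroup : ∀ s₂ a s₁ b → s₂ * a + s₁ * (s₁ * b) ≡ a * s₂ + b * (s₁ * s₁)
        regroup = solve-∀
        row : ∀ β → ∑ (vectors m) (λ γ → #F⁻¹ γ * (𝟙 (β ≟ᵥ γ) * a + + pᵐ⁻¹)) ≡ #F⁻¹ β * a + S₁ * + pᵐ⁻¹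
        row β = begin
          ∑ (vectors m) (λ γ → #F⁻¹ γ * (𝟙 (β ≟ᵥ γ) * a + + pᵐ⁻¹))
            ≡⟨ ∑-cong (vectors m) (λ γ → expand (#F⁻¹ γ) (𝟙 (β ≟ᵥ γ)) a (+ pᵐ⁻¹)) ⟩
          ∑ (vectors m) (λ γ → 𝟙 (β ≟ᵥ γ) * (#F⁻¹ γ * a) + #F⁻¹ γ * + pᵐ⁻¹)
            ≡⟨ ∑-+ (vectors m) (λ γ → 𝟙 (β ≟ᵥ γ) * (#F⁻¹ γ * a)) (λ γ → #F⁻¹ γ * + pᵐ⁻¹) ⟩
          ∑ (vectors m) (λ γ → 𝟙 (β ≟ᵥ γ) * (#F⁻¹ γ * a)) + ∑ (vectors m) (λ γ → #F⁻¹ γ * + pᵐ⁻¹)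
            ≡⟨ cong₂ _+_ (∑-δ-vectors′ m β (λ γ → #F⁻¹ γ * a)) (∑-*ʳ (vectors m) (+ pᵐ⁻¹) #F⁻¹) ⟩
          #F⁻¹ β * a + S₁ * + pᵐ⁻¹ ∎
          where expand : ∀ n i a b → n * (i * a + b) ≡ i * (n * a) + n * b
                expand = solve-∀

    correlation-zero : ∀ j → correlation (zeroVec p m) j ≡ δ₀ j * (S₁ * S₁)
    correlation-zero j = begin
      correlation (zeroVec p m) j
        ≡⟨ ∑-cong (vectors m) (λ β → cong (#F⁻¹ β *_) (∑-cong (vectors m) (λ γ → cong (#F⁻¹ γ *_)
             (cong₂ δₚ (dotℕ-zeroˡ β) (cong (ℕ._+ toℕ j) (dotℕ-zeroˡ γ)))))) ⟩
      ∑ (vectors m) (λ β → #F⁻¹ β * ∑ (vectors m) (λ γ → #F⁻¹ γ * δ₀ j))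
        ≡⟨ ∑-cong (vectors m) (λ β → cong (#F⁻¹ β *_) (∑-*ʳ (vectors m) (δ₀ j) #F⁻¹)) ⟩
      ∑ (vectors m) (λ β → #F⁻¹ β * (S₁ * δ₀ j))
        ≡⟨ ∑-*ʳ (vectors m) (S₁ * δ₀ j) #F⁻¹ ⟩
      S₁ * (S₁ * δ₀ j)
        ≡⟨ regroup S₁ (δ₀ j) ⟩
      δ₀ j * (S₁ * S₁) ∎
      where open ≡-Reasoning
            regroup : ∀ s e → s * (s * e) ≡ e * (s * s)
            regroup = solve-∀

    pmImbalance-coef : ∀ j → pmImbalance p F j ≡ δ₀ j * spread + offset
    pmImbalance-coef j = begin
      pmImbalance p F j
        ≡⟨ sumᶜ-coef (λ b → absSq p (walshF p F b (zeroVec p n))) nonzero j ⟩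
      ∑ nonzero (λ b → absSq p (walshF p F b (zeroVec p n)) j)
        ≡⟨ ∑-filter (λ b → ¬? (b ≟ᵥ zeroVec p m)) (vectors m) (λ b → absSq p (walshF p F b (zeroVec p n)) j) ⟩
      ∑ (vectors m) (λ b → 𝟙 (¬? (b ≟ᵥ zeroVec p m)) * absSq p (walshF p F b (zeroVec p n)) j)
        ≡⟨ ∑-cong (vectors m) (λ b → trans (cong₂ _*_ (𝟙-¬ (b ≟ᵥ zeroVec p m)) (absSq-walsh-zero b j))
                                          (complement (𝟙 (b ≟ᵥ zeroVec p m)) (correlation b j))) ⟩
      ∑ (vectors m) (λ b → correlation b j - 𝟙 (b ≟ᵥ zeroVec p m) * correlation b j)
        ≡⟨ ∑-- (vectors m) (λ b → correlation b j) (λ b → 𝟙 (b ≟ᵥ zeroVec p m) * correlation b j) ⟩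
      ∑ (vectors m) (λ b → correlation b j) - ∑ (vectors m) (λ b → 𝟙 (b ≟ᵥ zeroVec p m) * correlation b j)
        ≡⟨ cong₂ _-_ (∑-correlation j) (trans (∑-δ-vectors m (zeroVec p m) (λ b → correlation b j)) (correlation-zero j)) ⟩
      (+ pᵐ * δ₀ j - + pᵐ⁻¹) * S₂ + + pᵐ⁻¹ * (S₁ * S₁) - δ₀ j * (S₁ * S₁)
        ≡⟨ regroup (+ pᵐ) (δ₀ j) (+ pᵐ⁻¹) S₂ S₁ ⟩
      δ₀ j * spread + offset ∎
      where
        open ≡-Reasoning
        nonzero = filter (λ b → ¬? (b ≟ᵥ zeroVec p m)) (vectors m)
        complement : ∀ i t → (+ 1 - i) * t ≡ t - i * t
        complement = solve-∀
        regroup : ∀ M e B s₂ s₁ → (M * e - B) * s₂ + B * (s₁ * s₁) - e * (s₁ * s₁) ≡ e * (M * s₂ - s₁ * s₁) + (B * (s₁ * s₁) - B * s₂)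
        regroup = solve-∀

    module OneExceptionalFibre (A c : ℤ) (β₀ : Fpⁿ p m)
                               (fibres : ∀ β → + pᵐ * #F⁻¹ β ≡ A - + pᵐ * c * 𝟙 (β ≟ᵥ β₀)) where

      D : ℤ
      D = + pᵐ * c

      baseline : ℤ
      baseline = A * (+ pᵐ * (A * + pᵐ⁻¹) - D * + pᵐ⁻¹) - D * (A * + pᵐ⁻¹)

      pᵐ²-correlation : ∀ b → b ≢ zeroVec p m → ∀ j → + pᵐ * (+ pᵐ * correlation b j) ≡ baseline + D * D * δ₀ j
      pᵐ²-correlation b b≢0 j = begin
        + pᵐ * (+ pᵐ * correlation b j)
          ≡⟨ cong (+ pᵐ *_) (∑-*ˡ (vectors m) (+ pᵐ) (λ β → #F⁻¹ β * R β)) ⟨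
        + pᵐ * ∑ (vectors m) (λ β → + pᵐ * (#F⁻¹ β * R β))
          ≡⟨ ∑-*ˡ (vectors m) (+ pᵐ) (λ β → + pᵐ * (#F⁻¹ β * R β)) ⟨
        ∑ (vectors m) (λ β → + pᵐ * (+ pᵐ * (#F⁻¹ β * R β)))
          ≡⟨ ∑-cong (vectors m) (λ β → trans (regroup (+ pᵐ) (#F⁻¹ β) (R β))
                                             (cong ((+ pᵐ * #F⁻¹ β) *_) (sym (∑-*ˡ (vectors m) (+ pᵐ) (λ γ → #F⁻¹ γ * k β γ))))) ⟩
        ∑ (vectors m) (λ β → (+ pᵐ * #F⁻¹ β) * ∑ (vectors m) (λ γ → + pᵐ * (#F⁻¹ γ * k β γ)))
          ≡⟨ ∑-cong (vectors m) (λ β → cong₂ _*_ (fibres β)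
               (∑-cong (vectors m) (λ γ → trans (sym (ℤP.*-assoc (+ pᵐ) (#F⁻¹ γ) (k β γ))) (cong (_* k β γ) (fibres γ))))) ⟩
        ∑ (vectors m) (λ β → w β * ∑ (vectors m) (λ γ → w γ * k β γ))
          ≡⟨ ∑-cong (vectors m) (λ β → cong (w β *_) (trans (∑-exceptional A D β₀ (k β))
               (cong (λ s → A * s - D * k β β₀) (hyperplane-sizeʳ b b≢0 (dotℕ p b β) (toℕ j))))) ⟩
        ∑ (vectors m) (λ β → w β * (A * + pᵐ⁻¹ - D * k β β₀))
          ≡⟨ ∑-exceptional A D β₀ (λ β → A * + pᵐ⁻¹ - D * k β β₀) ⟩
        A * ∑ (vectors m) (λ β → A * + pᵐ⁻¹ - D * k β β₀) - D * (A * + pᵐ⁻¹ - D * k β₀ β₀)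
          ≡⟨ cong₂ (λ s t → A * s - D * (A * + pᵐ⁻¹ - D * t)) column-sum (δₚ-self (dotℕ p b β₀) j) ⟩
        A * (+ pᵐ * (A * + pᵐ⁻¹) - D * + pᵐ⁻¹) - D * (A * + pᵐ⁻¹ - D * δ₀ j)
          ≡⟨ expand A (+ pᵐ * (A * + pᵐ⁻¹) - D * + pᵐ⁻¹) D (A * + pᵐ⁻¹) (δ₀ j) ⟩
        baseline + D * D * δ₀ j ∎
        where
          open ≡-Reasoning
          k : Fpⁿ p m → Fpⁿ p m → ℤ
          k β γ = δₚ (dotℕ p b β) (dotℕ p b γ ℕ.+ toℕ j)
          R : Fpⁿ p m → ℤ
          R β = ∑ (vectors m) (λ γ → #F⁻¹ γ * k β γ)
          w : Fpⁿ p m → ℤ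
          w β = A - D * 𝟙 (β ≟ᵥ β₀)
          regroup : ∀ M n s → M * (M * (n * s)) ≡ (M * n) * (M * s)
          regroup = solve-∀
          expand : ∀ A u D v e → A * u - D * (v - D * e) ≡ A * u - D * v + D * D * e
          expand = solve-∀
          column-sum : ∑ (vectors m) (λ β → A * + pᵐ⁻¹ - D * k β β₀) ≡ + pᵐ * (A * + pᵐ⁻¹) - D * + pᵐ⁻¹
          column-sum = trans (∑-- (vectors m) (λ _ → A * + pᵐ⁻¹) (λ β → D * k β β₀))
            (cong₂ _-_ (∑-vectors-const m (A * + pᵐ⁻¹))
                       (trans (∑-*ˡ (vectors m) D (λ β → k β β₀)) (cong (D *_) (hyperplane-sizeˡ b b≢0 (dotℕ p b β₀ ℕ.+ toℕ j)))))

      correlation-affine : ∀ b → b ≢ zeroVec p m → ∀ j → correlation b j ≡ c * c * δ₀ j + (correlation b 0F - c * c)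
      correlation-affine b b≢0 j =
        trans (split (correlation b j) (c * c * δ₀ j))
              (cong (_+_ (c * c * δ₀ j)) (ℤP.*-cancelˡ-≡ (+ pᵐ) _ _ (ℤP.*-cancelˡ-≡ (+ pᵐ) _ _ scaled)))
        where
          split : ∀ t u → t ≡ u + (t - u)
          split = solve-∀
          pull : ∀ M t c e → M * (M * (t - c * c * e)) ≡ M * (M * t) - (M * c) * (M * c) * e
          pull = solve-∀
          cancel : ∀ K D e → K + D * D * e - D * D * e ≡ K
          cancel = solve-∀
          scaled : + pᵐ * (+ pᵐ * (correlation b j - c * c * δ₀ j)) ≡ + pᵐ * (+ pᵐ * (correlation b 0F - c * c))
          scaled = begin
            + pᵐ * (+ pᵐ * (correlation b j - c * c * δ₀ j))     ≡⟨ pull (+ pᵐ) (correlation b j) c (δ₀ j) ⟩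
            + pᵐ * (+ pᵐ * correlation b j) - D * D * δ₀ j       ≡⟨ cong (_- D * D * δ₀ j) (pᵐ²-correlation b b≢0 j) ⟩
            baseline + D * D * δ₀ j - D * D * δ₀ j               ≡⟨ cancel baseline D (δ₀ j) ⟩
            baseline                                             ≡⟨ cancel baseline D (δ₀ 0F) ⟨
            baseline + D * D * δ₀ 0F - D * D * δ₀ 0F             ≡⟨ cong (_- D * D * δ₀ 0F) (pᵐ²-correlation b b≢0 0F) ⟨
            + pᵐ * (+ pᵐ * correlation b 0F) - D * D * δ₀ 0F     ≡⟨ pull (+ pᵐ) (correlation b 0F) c (δ₀ 0F) ⟨
            + pᵐ * (+ pᵐ * (correlation b 0F - c * c * δ₀ 0F))   ≡⟨ cong (λ z → + pᵐ * (+ pᵐ * (correlation b 0F - z))) (ℤP.*-identityʳ (c * c)) ⟩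
            + pᵐ * (+ pᵐ * (correlation b 0F - c * c))           ∎
            where open ≡-Reasoning

      absSq-walsh-zero≈c² : ∀ b → b ≢ zeroVec p m → _≈ᶜ_ p (absSq p (walshF p F b (zeroVec p n))) (intᶜ p (c * c))
      absSq-walsh-zero≈c² b b≢0 = correlation b 0F - c * c , λ j →
        trans (absSq-walsh-zero b j) (trans (correlation-affine b b≢0 j) (cong (_+ (correlation b 0F - c * c)) (sym (intᶜ-coef (c * c) j))))

    module AlmostBalancedSurjective (AB : AlmostBalanced p F) (surj : Surjective p F) where

      XiSqScaled-coef : ∀ k → XiSqScaled p F k ≡ (+ pᵐ - + 1) * (+ pᵐ * (δ₀ k * spread + offset))
      XiSqScaled-coef k = trans (XiSqScaled-surjective surj k) (cong (λ z → (+ pᵐ - + 1) * (+ pᵐ * z)) (pmImbalance-coef k))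

      spread≢0 : spread ≢ + 0
      spread≢0 spread≡0 = proj₁ AB ((+ pᵐ - + 1) * (+ pᵐ * offset) , λ k →
        trans (XiSqScaled-coef k) (trans (cong (λ z → (+ pᵐ - + 1) * (+ pᵐ * (δ₀ k * z + offset))) spread≡0) (regroup (+ pᵐ) (δ₀ k) offset)))
        where regroup : ∀ M e C → (M - + 1) * (M * (e * + 0 + C)) ≡ + 0 + (M - + 1) * (M * C)
              regroup = solve-∀

      excess : Fpⁿ p m → ℤ
      excess β = + pᵐ * #F⁻¹ β - + pⁿ

      β₀ : Fpⁿ p m
      β₀ = proj₁ (proj₂ AB)

      excess-β₀ : excess β₀ ≡ + (imSize p F ℕ.* preimSize p F β₀) - + pⁿ
      excess-β₀ = cong (_- + pⁿ) (begin
        + pᵐ * #F⁻¹ β₀                          ≡⟨ cong (+ pᵐ *_) (preimSize≡#F⁻¹ β₀) ⟨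
        + pᵐ * + preimSize p F β₀               ≡⟨ ℤP.pos-* pᵐ (preimSize p F β₀) ⟨
        + (pᵐ ℕ.* preimSize p F β₀)             ≡⟨ cong (λ I → + (I ℕ.* preimSize p F β₀)) (imSize-surjective surj) ⟨
        + (imSize p F ℕ.* preimSize p F β₀)     ∎)
        where open ≡-Reasoning

      pᵐexcess²-β₀ : + pᵐ * (excess β₀ * excess β₀) ≡ (+ pᵐ - + 1) * (+ pᵐ * spread)
      pᵐexcess²-β₀ = begin
        + pᵐ * (excess β₀ * excess β₀)
          ≡⟨ cong (λ z → + pᵐ * (z * z)) excess-β₀ ⟩
        intᶜ p (+ pᵐ * (d * d)) 0F
          ≡⟨ almost-balanced 0F ⟩
        XiSqScaled p F 0F + c₀
          ≡⟨ cong (_+ c₀) (XiSqScaled-coef 0F) ⟩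
        (+ pᵐ - + 1) * (+ pᵐ * (+ 1 * spread + offset)) + c₀
          ≡⟨ regroup (+ pᵐ) spread offset c₀ ⟩
        (+ pᵐ - + 1) * (+ pᵐ * spread) + ((+ pᵐ - + 1) * (+ pᵐ * (+ 0 * spread + offset)) + c₀)
          ≡⟨ cong (λ z → (+ pᵐ - + 1) * (+ pᵐ * spread) + (z + c₀))
               (trans (XiSqScaled-coef (sucF 0F)) (cong (λ z → (+ pᵐ - + 1) * (+ pᵐ * (z * spread + offset))) δ₀-1)) ⟨
        (+ pᵐ - + 1) * (+ pᵐ * spread) + (XiSqScaled p F (sucF 0F) + c₀)
          ≡⟨ cong (_+_ ((+ pᵐ - + 1) * (+ pᵐ * spread))) (almost-balanced (sucF 0F)) ⟨
        (+ pᵐ - + 1) * (+ pᵐ * spread) + + 0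
          ≡⟨ ℤP.+-identityʳ _ ⟩
        (+ pᵐ - + 1) * (+ pᵐ * spread) ∎
        where
          open ≡-Reasoning
          d = + (imSize p F ℕ.* preimSize p F β₀) - + pⁿ
          c₀ = proj₁ (proj₂ (proj₂ AB))
          almost-balanced : ∀ k → intᶜ p (+ pᵐ * (d * d)) k ≡ XiSqScaled p F k + c₀
          almost-balanced = proj₂ (proj₂ (proj₂ AB))
          regroup : ∀ M Q C c → (M - + 1) * (M * (+ 1 * Q + C)) + c ≡ (M - + 1) * (M * Q) + ((M - + 1) * (M * (+ 0 * Q + C)) + c)
          regroup = solve-∀

      ∑excess≡0 : ∑ (vectors m) excess ≡ + 0
      ∑excess≡0 = trans (∑-- (vectors m) (λ β → + pᵐ * #F⁻¹ β) (λ _ → + pⁿ))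
        (trans (cong₂ _-_ (trans (∑-*ˡ (vectors m) (+ pᵐ) #F⁻¹) (cong (+ pᵐ *_) ∑#F⁻¹≡pⁿ)) (∑-vectors-const m (+ pⁿ)))
               (ℤP.+-inverseʳ (+ pᵐ * + pⁿ)))

      ∑excess² : ∑ (vectors m) (λ β → excess β * excess β) ≡ + pᵐ * spread
      ∑excess² = begin
        ∑ (vectors m) (λ β → excess β * excess β)
          ≡⟨ ∑-cong (vectors m) (λ β → expand (+ pᵐ) (#F⁻¹ β) (+ pⁿ)) ⟩
        ∑ (vectors m) (λ β → (+ pᵐ * + pᵐ) * (#F⁻¹ β * #F⁻¹ β) - (+ 2 * + pᵐ * + pⁿ) * #F⁻¹ β + + pⁿ * + pⁿ)
          ≡⟨ ∑-+ (vectors m) (λ β → (+ pᵐ * + pᵐ) * (#F⁻¹ β * #F⁻¹ β) - (+ 2 * + pᵐ * + pⁿ) * #F⁻¹ β) (λ _ → + pⁿ * + pⁿ) ⟩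
        ∑ (vectors m) (λ β → (+ pᵐ * + pᵐ) * (#F⁻¹ β * #F⁻¹ β) - (+ 2 * + pᵐ * + pⁿ) * #F⁻¹ β) + ∑ (vectors m) (λ _ → + pⁿ * + pⁿ)
          ≡⟨ cong₂ _+_ (trans (∑-- (vectors m) (λ β → (+ pᵐ * + pᵐ) * (#F⁻¹ β * #F⁻¹ β)) (λ β → (+ 2 * + pᵐ * + pⁿ) * #F⁻¹ β))
                              (cong₂ _-_ (∑-*ˡ (vectors m) (+ pᵐ * + pᵐ) (λ β → #F⁻¹ β * #F⁻¹ β))
                                         (trans (∑-*ˡ (vectors m) (+ 2 * + pᵐ * + pⁿ) #F⁻¹) (cong ((+ 2 * + pᵐ * + pⁿ) *_) ∑#F⁻¹≡pⁿ))))
                       (∑-vectors-const m (+ pⁿ * + pⁿ)) ⟩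
        (+ pᵐ * + pᵐ) * S₂ - (+ 2 * + pᵐ * + pⁿ) * + pⁿ + + pᵐ * (+ pⁿ * + pⁿ)
          ≡⟨ regroup (+ pᵐ) S₂ (+ pⁿ) ⟩
        + pᵐ * (+ pᵐ * S₂ - + pⁿ * + pⁿ)
          ≡⟨ cong (λ z → + pᵐ * (+ pᵐ * S₂ - z * z)) ∑#F⁻¹≡pⁿ ⟨
        + pᵐ * spread ∎
        where
          open ≡-Reasoning
          expand : ∀ M N P → (M * N - P) * (M * N - P) ≡ (M * M) * (N * N) - (+ 2 * M * P) * N + P * P
          expand = solve-∀
          regroup : ∀ M S P → (M * M) * S - (+ 2 * M * P) * P + M * (P * P) ≡ M * (M * S - P * P)
          regroup = solve-∀

      balanced-off-β₀ : ∀ β → β ≢ β₀ → (+ pᵐ - + 1) * excess β + excess β₀ ≡ + 0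
      balanced-off-β₀ = cauchy-schwarz-equality excess β₀ ∑excess≡0
        (trans pᵐexcess²-β₀ (cong ((+ pᵐ - + 1) *_) (sym ∑excess²)))

      c : ℤ
      c = excess (another β₀)

      excess-off-β₀ : ∀ β → β ≢ β₀ → excess β ≡ c
      excess-off-β₀ β β≢β₀ = ℤP.*-cancelˡ-≡ (+ pᵐ - + 1) (excess β) c (begin
        (+ pᵐ - + 1) * excess β                          ≡⟨ shift (+ pᵐ - + 1) (excess β) (excess β₀) ⟩
        (+ pᵐ - + 1) * excess β + excess β₀ - excess β₀  ≡⟨ cong (_- excess β₀) (trans (balanced-off-β₀ β β≢β₀)
                                                                                  (sym (balanced-off-β₀ (another β₀) (another-≢ β₀)))) ⟩
        (+ pᵐ - + 1) * c + excess β₀ - excess β₀         ≡⟨ shift (+ pᵐ - + 1) c (excess β₀) ⟨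
        (+ pᵐ - + 1) * c                                 ∎)
        where open ≡-Reasoning
              shift : ∀ a x e → a * x ≡ a * x + e - e
              shift = solve-∀

      excess-β₀≡ : excess β₀ ≡ - ((+ pᵐ - + 1) * c)
      excess-β₀≡ = begin
        excess β₀                                                ≡⟨ shift ((+ pᵐ - + 1) * c) (excess β₀) ⟩
        (+ pᵐ - + 1) * c + excess β₀ - (+ pᵐ - + 1) * c          ≡⟨ cong (_- (+ pᵐ - + 1) * c) (balanced-off-β₀ (another β₀) (another-≢ β₀)) ⟩
        + 0 - (+ pᵐ - + 1) * c                                   ≡⟨ ℤP.+-identityˡ _ ⟩
        - ((+ pᵐ - + 1) * c)                                     ∎
        where open ≡-Reasoning
              shift : ∀ a e → e ≡ a + e - a
              shift = solve-∀

      fibres : ∀ β → + pᵐ * #F⁻¹ β ≡ + pⁿ + c - + pᵐ * c * 𝟙 (β ≟ᵥ β₀)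
      fibres β = fibre-at (β ≟ᵥ β₀)
        where
          unshift : ∀ a b → a ≡ a - b + b
          unshift = solve-∀
          fibre-at : (d : Dec (β ≡ β₀)) → + pᵐ * #F⁻¹ β ≡ + pⁿ + c - + pᵐ * c * 𝟙 d
          fibre-at (yes refl) = trans (unshift (+ pᵐ * #F⁻¹ β₀) (+ pⁿ)) (trans (cong (_+ + pⁿ) excess-β₀≡) (regroup (+ pᵐ) c (+ pⁿ)))
            where regroup : ∀ M c P → - ((M - + 1) * c) + P ≡ P + c - M * c * + 1
                  regroup = solve-∀
          fibre-at (no β≢β₀) = trans (unshift (+ pᵐ * #F⁻¹ β) (+ pⁿ)) (trans (cong (_+ + pⁿ) (excess-off-β₀ β β≢β₀)) (regroup (+ pᵐ) c (+ pⁿ)))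
            where regroup : ∀ M c P → c + P ≡ P + c - M * c * + 0
                  regroup = solve-∀

      c≢0 : c ≢ + 0
      c≢0 c≡0 = spread≢0 (ℤP.*-cancelˡ-≡ (+ pᵐ) spread (+ 0) (begin
        + pᵐ * spread                                ≡⟨ ∑excess² ⟨
        ∑ (vectors m) (λ β → excess β * excess β)    ≡⟨ ∑-zero (vectors m) (λ β → cong (λ e → e * e) (excess≡0 β (β ≟ᵥ β₀))) ⟩
        + 0                                          ≡⟨ ℤP.*-zeroʳ (+ pᵐ) ⟨
        + pᵐ * + 0                                   ∎))
        where
          open ≡-Reasoning
          excess≡0 : ∀ β → Dec (β ≡ β₀) → excess β ≡ + 0
          excess≡0 β (yes refl) = trans excess-β₀≡ (trans (cong (λ z → - ((+ pᵐ - + 1) * z)) c≡0) (cong -_ (ℤP.*-zeroʳ (+ pᵐ - + 1))))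
          excess≡0 β (no β≢β₀) = trans (excess-off-β₀ β β≢β₀) c≡0

      pᵐ∣c : ∃ λ r → ∣ c ∣ ≡ pᵐ ℕ.* r
      pᵐ∣c = ∣ #F⁻¹ (another β₀) - + pⁿ⁻ᵐ ∣ , (begin
        ∣ + pᵐ * N₁ - + pⁿ ∣                  ≡⟨ cong (λ z → ∣ + pᵐ * N₁ - + z ∣) pⁿ≡pᵐpⁿ⁻ᵐ ⟩
        ∣ + pᵐ * N₁ - + (pᵐ ℕ.* pⁿ⁻ᵐ) ∣        ≡⟨ cong (λ z → ∣ + pᵐ * N₁ - z ∣) (ℤP.pos-* pᵐ pⁿ⁻ᵐ) ⟩
        ∣ + pᵐ * N₁ - + pᵐ * + pⁿ⁻ᵐ ∣          ≡⟨ cong ∣_∣ (factor (+ pᵐ) N₁ (+ pⁿ⁻ᵐ)) ⟩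
        ∣ + pᵐ * (N₁ - + pⁿ⁻ᵐ) ∣               ≡⟨ ℤP.abs-* (+ pᵐ) (N₁ - + pⁿ⁻ᵐ) ⟩
        pᵐ ℕ.* ∣ N₁ - + pⁿ⁻ᵐ ∣                ∎)
        where
          open ≡-Reasoning
          N₁ = #F⁻¹ (another β₀)
          pⁿ⁻ᵐ = p ^ (n ∸ m)
          pⁿ≡pᵐpⁿ⁻ᵐ : pⁿ ≡ pᵐ ℕ.* pⁿ⁻ᵐ
          pⁿ≡pᵐpⁿ⁻ᵐ = trans (cong (p ^_) (sym (ℕP.m+[n∸m]≡n (m≤n surj)))) (ℕP.^-distribˡ-+-* p m (n ∸ m))
          factor : ∀ M N P → M * N - M * P ≡ M * (N - P)
          factor = solve-∀

      open OneExceptionalFibre (+ pⁿ + c) c β₀ fibres using (absSq-walsh-zero≈c²)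

      module Plateaued (plateaued : IsPlateaued p F) where

        K : ℕ
        K = ∣ c ∣ ℕ.* ∣ c ∣

        K≢0 : K ≢ 0
        K≢0 K≡0 = c≢0 (ℤP.∣i∣≡0⇒i≡0 (reduce (ℕP.m*n≡0⇒m≡0∨n≡0 ∣ c ∣ K≡0)))

        amplitude : ∀ b → b ≢ zeroVec p m → ∀ s → IsPlateauedWith p (component p F b) s → ∃ λ k → (+ n + s ≡ + k) × (K ≡ p ^ k)
        amplitude b b≢0 s = plateau-amplitude (component p F b) s K K≢0
          (subst (λ z → _≈ᶜ_ p (absSq p (walshF p F b (zeroVec p n))) (intᶜ p z)) (i*i≡+∣i∣² c) (absSq-walsh-zero≈c² b b≢0))

        b₁ : Fpⁿ p m
        b₁ = another (zeroVec p m)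

        k₀ : ℕ
        k₀ = proj₁ (amplitude b₁ (another-≢ (zeroVec p m)) (proj₁ (plateaued b₁ (another-≢ _))) (proj₂ (plateaued b₁ (another-≢ _))))

        K≡pᵏ⁰ : K ≡ p ^ k₀
        K≡pᵏ⁰ = proj₂ (proj₂ (amplitude b₁ (another-≢ (zeroVec p m)) (proj₁ (plateaued b₁ (another-≢ _))) (proj₂ (plateaued b₁ (another-≢ _)))))

        t : ℤ
        t = + k₀ - + n

        single-amplitude : IsTPlateaued p F t
        single-amplitude b b≢0 = at (plateaued b b≢0)
          where
            shift : ∀ a s → s ≡ a + s - a
            shift = solve-∀
            at : (∃ λ s → IsPlateauedWith p (component p F b) s) → IsPlateauedWith p (component p F b) t
            at (s , plateaued-s) = subst (IsPlateauedWith p (component p F b)) s≡t plateaued-s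
              where
                k = proj₁ (amplitude b b≢0 s plateaued-s)
                n+s≡k = proj₁ (proj₂ (amplitude b b≢0 s plateaued-s))
                K≡pᵏ = proj₂ (proj₂ (amplitude b b≢0 s plateaued-s))
                s≡t : s ≡ t
                s≡t = trans (shift (+ n) s) (cong (_- + n) (trans n+s≡k (cong +_ (^-injectiveʳ k k₀ (trans (sym K≡pᵏ) K≡pᵏ⁰)))))

        j : ℕ
        j = proj₁ (square≡^⇒even k₀ ∣ c ∣ K≡pᵏ⁰)

        k₀≡j+j : k₀ ≡ j ℕ.+ j
        k₀≡j+j = proj₁ (proj₂ (square≡^⇒even k₀ ∣ c ∣ K≡pᵏ⁰))

        ∣c∣≡pʲ : ∣ c ∣ ≡ p ^ j
        ∣c∣≡pʲ = proj₂ (proj₂ (square≡^⇒even k₀ ∣ c ∣ K≡pᵏ⁰))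

        m≤j : m ℕ.≤ j
        m≤j = ^-cancelʳ-≤ m j (subst (pᵐ ℕ.≤_) (trans (sym (proj₂ pᵐ∣c)) ∣c∣≡pʲ) (ℕP.m≤m*n pᵐ (proj₁ pᵐ∣c) ⦃ ℕ.≢-nonZero r≢0 ⦄))
          where r≢0 : proj₁ pᵐ∣c ≢ 0
                r≢0 r≡0 = c≢0 (ℤP.∣i∣≡0⇒i≡0 (trans (proj₂ pᵐ∣c) (trans (cong (pᵐ ℕ.*_) r≡0) (ℕP.*-zeroʳ pᵐ))))

        n+t≡2j : + n + t ≡ + 2 * + j
        n+t≡2j = trans (cancel (+ n) (+ k₀)) (trans (cong +_ k₀≡j+j) (trans (ℤP.pos-+ j j) (double (+ j))))
          where cancel : ∀ a b → a + (b - a) ≡ b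
                cancel = solve-∀
                double : ∀ a → a + a ≡ + 2 * a
                double = solve-∀

  trivial-codomain-not-almost-balanced : ∀ n (F : Fpⁿ p n → Fpⁿ p 0) → Surjective p F → ¬ AlmostBalanced p F
  trivial-codomain-not-almost-balanced n F surj (Ξ≉0 , _) =
    Ξ≉0 (+ 0 , λ k → trans (XiSqScaled-surjective surj k) (ℤP.*-zeroˡ (+ 1 * pmImbalance p F k)))
    where open ValueDistribution n 0 F

corollary4p3 : (p : ℕ) .{{_ : NonZero p}} → Prime p → (n m : ℕ)
    → (F : Fpⁿ p n → Fpⁿ p m)
    → AlmostBalanced p F → Surjective p F → IsPlateaued p F
    → ∃ λ (t : ℤ) → IsTPlateaued p F t
        × ∃ λ (k : ℤ) → (+ n + t ≡ + 2 * k) × (+ m ≤ k)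
corollary4p3 zero ()
corollary4p3 (suc zero) ()
corollary4p3 (suc (suc q)) p-prime n zero F almost-balanced surj _ =
  ⊥-elim (trivial-codomain-not-almost-balanced n F surj almost-balanced)
  where open PrimeField q p-prime
corollary4p3 (suc (suc q)) p-prime n (suc m′) F almost-balanced surj plateaued =
  t , single-amplitude , + j , n+t≡2j , ℤ.+≤+ m≤j
  where open PrimeField q p-prime
        open NonTrivialCodomain n m′ F
        open AlmostBalancedSurjective almost-balanced surj
        open Plateaued plateaued
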